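{- Let $z^{1/2}$ and $q^{1/2}$ be independent indeterminates, put $z=(z^{1/2})^2$, $q=(q^{1/2})^2$, and work in the field $\mathbb{Q}(z^{1/2},q^{1/2})$ of rational functions. For integers $j\ge 0$ define $$\lambda(j)=\sum_{0\le k\le j/2}\begin{bmatrix} j-k\\ k\end{bmatrix}_q(-1)^kq^{k(k-1)}z^k .$$ For $n\ge 1$, let $M=M(n)$ be the $n\times n$ tridiagonal matrix with entries $$M_{i,j}=\begin{cases}1 & \text{if } i=j,\\ z^{1/2}q^{(i-1)/2} & \text{if } i=j-1,\\ z^{1/2}q^{(i-2)/2} & \text{if } i=j+1,\\ 0 & \text{otherwise.}\end{cases}$$ Let $U$ be the $n\times n$ matrix with $U_{j,j}=\lambda(j)/\lambda(j-1)$ for $1\le j\le n$, $U_{j,j+1}=z^{1/2}q^{(j-1)/2}$ for $1\le j\le n-1$, and all other entries zero; and let $L$ be the $n\times n$ matrix with $L_{j,j}=1$ for $1\le j\le n$, $L_{j+1,j}=z^{1/2}q^{(j-1)/2}\,\lambda(j-1)/\lambda(j)$ for $1\le j\le n-1$, and all other entries zero. Then every $\lambda(j)$ is nonzero and $LU=M$.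
   Context: The Gaussian $q$-binomial coefficient is $\begin{bmatrix} n\\ k\end{bmatrix}_q=\frac{(q;q)_n}{(q;q)_k(q;q)_{n-k}}$, where $(x;q)_m=(1-x)(1-xq)\cdots(1-xq^{m-1})$ (and $(x;q)_0=1$). -}

module Defs where

open import Data.Nat as ℕ using (ℕ; zero; suc; _∸_; _≡ᵇ_)
open import Data.Nat.DivMod using (_/_)
open import Data.Integer as ℤ using (ℤ; +_)
open import Data.List using (List; []; _∷_; map; upTo)
open import Data.Fin using (Fin; toℕ)
open import Data.Bool using (if_then_else_)
open import Relation.Binary.PropositionalEquality using (_≡_)

-- ℤ[t] : univariate polynomials over ℤ as coefficient lists
-- (constant coefficient first); equality is coefficientwise, with
-- missing coefficients read as 0.

P1 : Set
P1 = List ℤ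

_+₁_ : P1 → P1 → P1
[] +₁ q = q
(a ∷ p) +₁ [] = a ∷ p
(a ∷ p) +₁ (b ∷ q) = (a ℤ.+ b) ∷ (p +₁ q)

_·₁_ : ℤ → P1 → P1
a ·₁ p = map (a ℤ.*_) p

_*₁_ : P1 → P1 → P1
[] *₁ q = []
(a ∷ p) *₁ q = (a ·₁ q) +₁ (+ 0 ∷ (p *₁ q))

neg₁ : P1 → P1
neg₁ = map (λ a → ℤ.- a)

coeff₁ : P1 → ℕ → ℤ
coeff₁ [] n = + 0
coeff₁ (a ∷ p) zero = a
coeff₁ (a ∷ p) (suc n) = coeff₁ p n

-- ℤ[s,t] = ℤ[t][s] : lists of s-coefficients, each in ℤ[t].
-- Here s stands for z^{1/2} and t for q^{1/2}.

P2 : Set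
P2 = List P1

_+₂_ : P2 → P2 → P2
[] +₂ q = q
(a ∷ p) +₂ [] = a ∷ p
(a ∷ p) +₂ (b ∷ q) = (a +₁ b) ∷ (p +₂ q)

_·₂_ : P1 → P2 → P2
a ·₂ p = map (a *₁_) p

_*₂_ : P2 → P2 → P2
[] *₂ q = []
(a ∷ p) *₂ q = (a ·₂ q) +₂ ([] ∷ (p *₂ q))

neg₂ : P2 → P2
neg₂ = map neg₁

coeff₂ : P2 → ℕ → ℕ → ℤ
coeff₂ [] m n = + 0
coeff₂ (a ∷ p) zero n = coeff₁ a n
coeff₂ (a ∷ p) (suc m) n = coeff₂ p m n

_≈₂_ : P2 → P2 → Set
p ≈₂ q = ∀ m n → coeff₂ p m n ≡ coeff₂ q m n

-- The field ℚ(s,t) = Frac ℤ[s,t], elements as fractions num/den.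
-- (Every fraction arising below has a nonzero denominator.)

record Frac : Set where
  constructor _//_
  field
    num : P2
    den : P2
open Frac public

infix 4 _≈_
_≈_ : Frac → Frac → Set
x ≈ y = (num x *₂ den y) ≈₂ (num y *₂ den x)

one₂ : P2
one₂ = (+ 1 ∷ []) ∷ []

0F 1F : Frac
0F = [] // one₂
1F = one₂ // one₂

infixl 6 _+F_ _-F_
infixl 7 _*F_ _÷F_

_+F_ : Frac → Frac → Frac
(a // b) +F (c // d) = ((a *₂ d) +₂ (c *₂ b)) // (b *₂ d)

-F_ : Frac → Frac
-F (a // b) = neg₂ a // b

_-F_ : Frac → Frac → Frac
x -F y = x +F (-F y)

_*F_ : Frac → Frac → Frac
(a // b) *F (c // d) = (a *₂ c) // (b *₂ d)

_÷F_ : Frac → Frac → Frac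
(a // b) ÷F (c // d) = (a *₂ d) // (b *₂ c)

_^F_ : Frac → ℕ → Frac
x ^F zero = 1F
x ^F suc n = x *F (x ^F n)

sF tF zF qF : Frac
sF = ([] ∷ (+ 1 ∷ []) ∷ []) // one₂
tF = ((+ 0 ∷ + 1 ∷ []) ∷ []) // one₂
zF = sF *F sF
qF = tF *F tF

qpoch : ℕ → Frac
qpoch zero = 1F
qpoch (suc m) = qpoch m *F (1F -F (qF ^F suc m))

qbinom : ℕ → ℕ → Frac
qbinom n k = qpoch n ÷F (qpoch k *F qpoch (n ∸ k))

sumL : List ℕ → (ℕ → Frac) → Frac
sumL [] f = 0F
sumL (k ∷ ks) f = f k +F sumL ks f

lam : ℕ → Frac
lam j = sumL (upTo (suc (j / 2)))
  (λ k → qbinom (j ∸ k) k *F ((-F 1F) ^F k) *F (qF ^F (k ℕ.* (k ∸ 1))) *F (zF ^F k))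

-- n×n matrices over ℚ(s,t), indexed 0..n-1 (paper index i ↔ toℕ i + 1).

Mat : ℕ → Set
Mat n = Fin n → Fin n → Frac

sumFin : (n : ℕ) → (Fin n → Frac) → Frac
sumFin zero f = 0F
sumFin (suc n) f = f Fin.zero +F sumFin n (λ i → f (Fin.suc i))
  where import Data.Fin as Fin

_⊗_ : ∀ {n} → Mat n → Mat n → Mat n
_⊗_ {n} A B i j = sumFin n (λ k → A i k *F B k j)

_≈M_ : ∀ {n} → Mat n → Mat n → Set
A ≈M B = ∀ i j → A i j ≈ B i j

-- M: 1 on diagonal; paper (i,i+1) entry z^{1/2} q^{(i-1)/2};
-- paper (j+1,j) entry z^{1/2} q^{(j-1)/2}  (= z^{1/2} q^{(i-2)/2} with i=j+1).
-- 0-indexed: (a,a+1) and (a+1,a) entries are s t^a.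
Mmat : (n : ℕ) → Mat n
Mmat n i j =
  if toℕ i ≡ᵇ toℕ j then 1F
  else if suc (toℕ i) ≡ᵇ toℕ j then sF *F (tF ^F toℕ i)
  else if toℕ i ≡ᵇ suc (toℕ j) then sF *F (tF ^F toℕ j)
  else 0F

Umat : (n : ℕ) → Mat n
Umat n i j =
  if toℕ i ≡ᵇ toℕ j then lam (suc (toℕ i)) ÷F lam (toℕ i)
  else if suc (toℕ i) ≡ᵇ toℕ j then sF *F (tF ^F toℕ i)
  else 0F

Lmat : (n : ℕ) → Mat n
Lmat n i j =
  if toℕ i ≡ᵇ toℕ j then 1F
  else if toℕ i ≡ᵇ suc (toℕ j) then (sF *F (tF ^F toℕ j)) *F (lam (toℕ j) ÷F lam (suc (toℕ j)))
  else 0F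

-- Everything happens in ℤ[s,t] with s = z^{1/2}, t = q^{1/2}. The q-Pascal rule
-- [n+1, k+1] = [n, k+1] + q^{n-k} [n, k] shows (q;q)_n = [n, k] (q;q)_k (q;q)_{n-k} with a
-- polynomial [n, k], and then gives the three-term recurrence
-- λ(j+2) = λ(j+1) - z q^j λ(j), λ(0) = λ(1) = 1. So λ(j) has constant term 1 and is nonzero.
-- Every denominator that occurs has nonzero constant term; since the constant term is
-- multiplicative into ℤ, such polynomials are cancellable, and fractions can be compared by
-- cross-multiplication without knowing that ℤ[s,t] is a domain. Both L and U are banded, so
-- each entry of LU has at most two terms; the only two-term entries are the diagonal ones
-- z q^{i-2} λ(i-2)/λ(i-1) + λ(i)/λ(i-1), which equal 1 by the recurrence.

module Submission where

open import Algebra.Bundles using (CommutativeRing)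
open import Algebra.Core using (Op₁; Op₂)
open import Algebra.Structures using (IsCommutativeRing)
open import Data.List using (List; []; _∷_; map; applyUpTo)
open import Data.Nat using (ℕ; zero; suc)
open import Data.Product using (_×_; _,_)
open import Level using (0ℓ; _⊔_)
open import Relation.Binary.Bundles using (Setoid)
open import Relation.Binary.PropositionalEquality using (_≡_)
open import Relation.Binary.Structures using (IsEquivalence)

-- Polynomials over a commutative ring

module Polynomial {c ℓ} (R : CommutativeRing c ℓ) where

  open CommutativeRing R renaming (Carrier to A) hiding (zero; isCommutativeRing)
  open import Relation.Binary.Reasoning.MultiSetoid
  open import Algebra.Properties.Ring ring using (-0#≈0#)

  Poly : Set c
  Poly = List A

  infixl 6 _⊕_
  infixl 7 _⊛_ _·_

  _⊕_ : Poly → Poly → Poly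
  [] ⊕ q = q
  (a ∷ p) ⊕ [] = a ∷ p
  (a ∷ p) ⊕ (b ∷ q) = (a + b) ∷ (p ⊕ q)

  _·_ : A → Poly → Poly
  a · p = map (a *_) p

  _⊛_ : Poly → Poly → Poly
  [] ⊛ q = []
  (a ∷ p) ⊛ q = a · q ⊕ (0# ∷ p ⊛ q)

  ⊖_ : Poly → Poly
  ⊖_ = map (-_)

  1ₚ : Poly
  1ₚ = 1# ∷ []

  coeff : Poly → ℕ → A
  coeff [] n = 0#
  coeff (a ∷ p) zero = a
  coeff (a ∷ p) (suc n) = coeff p n

  infix 4 _≋_
  record _≋_ (p q : Poly) : Set ℓ where
    constructor mk≋
    field at : ∀ n → coeff p n ≈ coeff q n
  open _≋_ public

  ≋-refl : ∀ {p} → p ≋ p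
  ≋-refl = mk≋ λ _ → refl

  ≋-sym : ∀ {p q} → p ≋ q → q ≋ p
  ≋-sym e = mk≋ λ n → sym (at e n)

  ≋-trans : ∀ {p q r} → p ≋ q → q ≋ r → p ≋ r
  ≋-trans e f = mk≋ λ n → trans (at e n) (at f n)

  ≋-isEquivalence : IsEquivalence _≋_
  ≋-isEquivalence = record { refl = ≋-refl ; sym = ≋-sym ; trans = ≋-trans }

  ≋-setoid : Setoid c ℓ
  ≋-setoid = record { isEquivalence = ≋-isEquivalence }

  ∷-cong : ∀ {a b p q} → a ≈ b → p ≋ q → a ∷ p ≋ b ∷ q
  ∷-cong a≈b p≋q = mk≋ λ { zero → a≈b ; (suc n) → at p≋q n }

  ∷-≋[] : ∀ {a p} → a ≈ 0# → p ≋ [] → a ∷ p ≋ []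
  ∷-≋[] a≈0 p≋[] = mk≋ λ { zero → a≈0 ; (suc n) → at p≋[] n }

  ∷-injective : ∀ {a b p q} → a ∷ p ≋ b ∷ q → a ≈ b × p ≋ q
  ∷-injective e = at e zero , mk≋ λ n → at e (suc n)

  coeff-⊕ : ∀ p q n → coeff (p ⊕ q) n ≈ coeff p n + coeff q n
  coeff-⊕ [] q n = sym (+-identityˡ _)
  coeff-⊕ (a ∷ p) [] n = sym (+-identityʳ _)
  coeff-⊕ (a ∷ p) (b ∷ q) zero = refl
  coeff-⊕ (a ∷ p) (b ∷ q) (suc n) = coeff-⊕ p q n

  coeff-· : ∀ a p n → coeff (a · p) n ≈ a * coeff p n
  coeff-· a [] n = sym (zeroʳ a)
  coeff-· a (b ∷ p) zero = refl
  coeff-· a (b ∷ p) (suc n) = coeff-· a p n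

  coeff-⊖ : ∀ p n → coeff (⊖ p) n ≈ - coeff p n
  coeff-⊖ [] n = sym -0#≈0#
  coeff-⊖ (a ∷ p) zero = refl
  coeff-⊖ (a ∷ p) (suc n) = coeff-⊖ p n

  coeff₀-⊛ : ∀ p q → coeff (p ⊛ q) 0 ≈ coeff p 0 * coeff q 0
  coeff₀-⊛ [] q = sym (zeroˡ _)
  coeff₀-⊛ (a ∷ p) q = begin⟨ setoid ⟩
    coeff (a · q ⊕ (0# ∷ p ⊛ q)) 0 ≈⟨ coeff-⊕ (a · q) (0# ∷ p ⊛ q) 0 ⟩
    coeff (a · q) 0 + 0#           ≈⟨ +-identityʳ _ ⟩
    coeff (a · q) 0                ≈⟨ coeff-· a q 0 ⟩
    a * coeff q 0                  ∎

  ⊕-cong : ∀ {p p′ q q′} → p ≋ p′ → q ≋ q′ → p ⊕ q ≋ p′ ⊕ q′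
  ⊕-cong {p} {p′} {q} {q′} e f = mk≋ λ n → begin⟨ setoid ⟩
    coeff (p ⊕ q) n         ≈⟨ coeff-⊕ p q n ⟩
    coeff p n + coeff q n   ≈⟨ +-cong (at e n) (at f n) ⟩
    coeff p′ n + coeff q′ n ≈⟨ coeff-⊕ p′ q′ n ⟨
    coeff (p′ ⊕ q′) n       ∎

  ·-cong : ∀ {a b p q} → a ≈ b → p ≋ q → a · p ≋ b · q
  ·-cong {a} {b} {p} {q} e f = mk≋ λ n → begin⟨ setoid ⟩
    coeff (a · p) n ≈⟨ coeff-· a p n ⟩
    a * coeff p n   ≈⟨ *-cong e (at f n) ⟩
    b * coeff q n   ≈⟨ coeff-· b q n ⟨
    coeff (b · q) n ∎

  ⊖-cong : ∀ {p q} → p ≋ q → ⊖ p ≋ ⊖ q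
  ⊖-cong {p} {q} e = mk≋ λ n → begin⟨ setoid ⟩
    coeff (⊖ p) n ≈⟨ coeff-⊖ p n ⟩
    - coeff p n   ≈⟨ -‿cong (at e n) ⟩
    - coeff q n   ≈⟨ coeff-⊖ q n ⟨
    coeff (⊖ q) n ∎

  ⊕-comm : ∀ p q → p ⊕ q ≋ q ⊕ p
  ⊕-comm p q = mk≋ λ n → begin⟨ setoid ⟩
    coeff (p ⊕ q) n       ≈⟨ coeff-⊕ p q n ⟩
    coeff p n + coeff q n ≈⟨ +-comm _ _ ⟩
    coeff q n + coeff p n ≈⟨ coeff-⊕ q p n ⟨
    coeff (q ⊕ p) n       ∎

  ⊕-assoc : ∀ p q r → (p ⊕ q) ⊕ r ≋ p ⊕ (q ⊕ r)
  ⊕-assoc p q r = mk≋ λ n → begin⟨ setoid ⟩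
    coeff ((p ⊕ q) ⊕ r) n                 ≈⟨ coeff-⊕ (p ⊕ q) r n ⟩
    coeff (p ⊕ q) n + coeff r n           ≈⟨ +-congʳ (coeff-⊕ p q n) ⟩
    (coeff p n + coeff q n) + coeff r n   ≈⟨ +-assoc _ _ _ ⟩
    coeff p n + (coeff q n + coeff r n)   ≈⟨ +-congˡ (coeff-⊕ q r n) ⟨
    coeff p n + coeff (q ⊕ r) n           ≈⟨ coeff-⊕ p (q ⊕ r) n ⟨
    coeff (p ⊕ (q ⊕ r)) n                 ∎

  ⊕-identityʳ : ∀ p → p ⊕ [] ≋ p
  ⊕-identityʳ [] = ≋-refl
  ⊕-identityʳ (a ∷ p) = ≋-refl

  ⊕-inverseˡ : ∀ p → ⊖ p ⊕ p ≋ []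
  ⊕-inverseˡ p = mk≋ λ n → begin⟨ setoid ⟩
    coeff (⊖ p ⊕ p) n         ≈⟨ coeff-⊕ (⊖ p) p n ⟩
    coeff (⊖ p) n + coeff p n ≈⟨ +-congʳ (coeff-⊖ p n) ⟩
    - coeff p n + coeff p n   ≈⟨ -‿inverseˡ _ ⟩
    0#                        ∎

  ⊕-inverseʳ : ∀ p → p ⊕ ⊖ p ≋ []
  ⊕-inverseʳ p = ≋-trans (⊕-comm p (⊖ p)) (⊕-inverseˡ p)

  ⊕-interchange : ∀ x y z w → (x ⊕ y) ⊕ (z ⊕ w) ≋ (x ⊕ z) ⊕ (y ⊕ w)
  ⊕-interchange x y z w = mk≋ λ n → begin⟨ setoid ⟩
    coeff ((x ⊕ y) ⊕ (z ⊕ w)) n                           ≈⟨ expand x y z w n ⟩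
    (coeff x n + coeff y n) + (coeff z n + coeff w n)     ≈⟨ +-assoc _ _ _ ⟩
    coeff x n + (coeff y n + (coeff z n + coeff w n))     ≈⟨ +-congˡ (+-assoc _ _ _) ⟨
    coeff x n + ((coeff y n + coeff z n) + coeff w n)     ≈⟨ +-congˡ (+-congʳ (+-comm _ _)) ⟩
    coeff x n + ((coeff z n + coeff y n) + coeff w n)     ≈⟨ +-congˡ (+-assoc _ _ _) ⟩
    coeff x n + (coeff z n + (coeff y n + coeff w n))     ≈⟨ +-assoc _ _ _ ⟨
    (coeff x n + coeff z n) + (coeff y n + coeff w n)     ≈⟨ expand x z y w n ⟨
    coeff ((x ⊕ z) ⊕ (y ⊕ w)) n                           ∎
    where
    expand : ∀ a b c d n →
      coeff ((a ⊕ b) ⊕ (c ⊕ d)) n ≈ (coeff a n + coeff b n) + (coeff c n + coeff d n)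
    expand a b c d n = trans (coeff-⊕ (a ⊕ b) (c ⊕ d) n) (+-cong (coeff-⊕ a b n) (coeff-⊕ c d n))

  ·-zeroˡ : ∀ {a} p → a ≈ 0# → a · p ≋ []
  ·-zeroˡ {a} p a≈0 = mk≋ λ n → trans (coeff-· a p n) (trans (*-congʳ a≈0) (zeroˡ _))

  ·-zeroʳ : ∀ a {p} → p ≋ [] → a · p ≋ []
  ·-zeroʳ a {p} p≋[] = mk≋ λ n → trans (coeff-· a p n) (trans (*-congˡ (at p≋[] n)) (zeroʳ a))

  ·-distribʳ : ∀ a b p → (a + b) · p ≋ a · p ⊕ b · p
  ·-distribʳ a b p = mk≋ λ n → begin⟨ setoid ⟩
    coeff ((a + b) · p) n             ≈⟨ coeff-· (a + b) p n ⟩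
    (a + b) * coeff p n               ≈⟨ distribʳ _ _ _ ⟩
    a * coeff p n + b * coeff p n     ≈⟨ +-cong (coeff-· a p n) (coeff-· b p n) ⟨
    coeff (a · p) n + coeff (b · p) n ≈⟨ coeff-⊕ (a · p) (b · p) n ⟨
    coeff (a · p ⊕ b · p) n           ∎

  ·-distribˡ : ∀ a p q → a · (p ⊕ q) ≋ a · p ⊕ a · q
  ·-distribˡ a p q = mk≋ λ n → begin⟨ setoid ⟩
    coeff (a · (p ⊕ q)) n             ≈⟨ coeff-· a (p ⊕ q) n ⟩
    a * coeff (p ⊕ q) n               ≈⟨ *-congˡ (coeff-⊕ p q n) ⟩
    a * (coeff p n + coeff q n)       ≈⟨ distribˡ _ _ _ ⟩
    a * coeff p n + a * coeff q n     ≈⟨ +-cong (coeff-· a p n) (coeff-· a q n) ⟨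
    coeff (a · p) n + coeff (a · q) n ≈⟨ coeff-⊕ (a · p) (a · q) n ⟨
    coeff (a · p ⊕ a · q) n           ∎

  ·-assoc : ∀ a b p → a · (b · p) ≋ (a * b) · p
  ·-assoc a b p = mk≋ λ n → begin⟨ setoid ⟩
    coeff (a · (b · p)) n ≈⟨ coeff-· a (b · p) n ⟩
    a * coeff (b · p) n   ≈⟨ *-congˡ (coeff-· b p n) ⟩
    a * (b * coeff p n)   ≈⟨ *-assoc _ _ _ ⟨
    (a * b) * coeff p n   ≈⟨ coeff-· (a * b) p n ⟨
    coeff ((a * b) · p) n ∎

  ·-identityˡ : ∀ p → 1# · p ≋ p
  ·-identityˡ p = mk≋ λ n → trans (coeff-· 1# p n) (*-identityˡ _)

  shift-cong : ∀ {p q} → p ≋ q → 0# ∷ p ≋ 0# ∷ q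
  shift-cong = ∷-cong refl

  shift-⊕ : ∀ p q → 0# ∷ (p ⊕ q) ≋ (0# ∷ p) ⊕ (0# ∷ q)
  shift-⊕ p q = ∷-cong (sym (+-identityˡ _)) ≋-refl

  shift-[] : 0# ∷ [] ≋ []
  shift-[] = ∷-≋[] refl ≋-refl

  ⊛-zeroˡ : ∀ {p} q → p ≋ [] → p ⊛ q ≋ []
  ⊛-zeroˡ {[]} q e = ≋-refl
  ⊛-zeroˡ {a ∷ p} q e =
    ≋-trans (⊕-cong (·-zeroˡ q (at e zero)) (shift-cong (⊛-zeroˡ q p≋[]))) shift-[]
    where
    p≋[] : p ≋ []
    p≋[] = mk≋ λ n → at e (suc n)

  ⊛-zeroʳ : ∀ p {q} → q ≋ [] → p ⊛ q ≋ []
  ⊛-zeroʳ [] e = ≋-refl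
  ⊛-zeroʳ (a ∷ p) e = ≋-trans (⊕-cong (·-zeroʳ a e) (shift-cong (⊛-zeroʳ p e))) shift-[]

  ⊛-congˡ : ∀ {p p′} q → p ≋ p′ → p ⊛ q ≋ p′ ⊛ q
  ⊛-congˡ {[]} q e = ≋-sym (⊛-zeroˡ q (≋-sym e))
  ⊛-congˡ {a ∷ p} {[]} q e = ⊛-zeroˡ q e
  ⊛-congˡ {a ∷ p} {b ∷ p′} q e =
    let a≈b , p≋p′ = ∷-injective e in
    ⊕-cong (·-cong a≈b ≋-refl) (shift-cong (⊛-congˡ q p≋p′))

  ⊛-congʳ : ∀ p {q q′} → q ≋ q′ → p ⊛ q ≋ p ⊛ q′
  ⊛-congʳ [] e = ≋-refl
  ⊛-congʳ (a ∷ p) e = ⊕-cong (·-cong refl e) (shift-cong (⊛-congʳ p e))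

  ⊛-cong : ∀ {p p′ q q′} → p ≋ p′ → q ≋ q′ → p ⊛ q ≋ p′ ⊛ q′
  ⊛-cong {p′ = p′} {q = q} e f = ≋-trans (⊛-congˡ q e) (⊛-congʳ p′ f)

  ⊛-distribʳ : ∀ q p p′ → (p ⊕ p′) ⊛ q ≋ p ⊛ q ⊕ p′ ⊛ q
  ⊛-distribʳ q [] p′ = ≋-refl
  ⊛-distribʳ q (a ∷ p) [] = ≋-sym (⊕-identityʳ _)
  ⊛-distribʳ q (a ∷ p) (b ∷ p′) =
    ≋-trans (⊕-cong (·-distribʳ a b q)
                    (≋-trans (shift-cong (⊛-distribʳ q p p′)) (shift-⊕ (p ⊛ q) (p′ ⊛ q))))
            (⊕-interchange (a · q) (b · q) (0# ∷ p ⊛ q) (0# ∷ p′ ⊛ q))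

  ⊛-distribˡ : ∀ p q q′ → p ⊛ (q ⊕ q′) ≋ p ⊛ q ⊕ p ⊛ q′
  ⊛-distribˡ [] q q′ = ≋-refl
  ⊛-distribˡ (a ∷ p) q q′ =
    ≋-trans (⊕-cong (·-distribˡ a q q′)
                    (≋-trans (shift-cong (⊛-distribˡ p q q′)) (shift-⊕ (p ⊛ q) (p ⊛ q′))))
            (⊕-interchange (a · q) (a · q′) (0# ∷ p ⊛ q) (0# ∷ p ⊛ q′))

  ·-⊛-assoc : ∀ a p q → (a · p) ⊛ q ≋ a · (p ⊛ q)
  ·-⊛-assoc a [] q = ≋-refl
  ·-⊛-assoc a (b ∷ p) q =
    ≋-trans (⊕-cong (≋-sym (·-assoc a b q))
                    (≋-trans (shift-cong (·-⊛-assoc a p q)) (∷-cong (sym (zeroʳ a)) ≋-refl)))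
            (≋-sym (·-distribˡ a (b · q) (0# ∷ p ⊛ q)))

  shift-⊛ : ∀ p q → (0# ∷ p) ⊛ q ≋ 0# ∷ p ⊛ q
  shift-⊛ p q = ⊕-cong (·-zeroˡ q refl) ≋-refl

  ⊛-assoc : ∀ p q r → (p ⊛ q) ⊛ r ≋ p ⊛ (q ⊛ r)
  ⊛-assoc [] q r = ≋-refl
  ⊛-assoc (a ∷ p) q r =
    ≋-trans (⊛-distribʳ r (a · q) (0# ∷ p ⊛ q))
            (⊕-cong (·-⊛-assoc a q r) (≋-trans (shift-⊛ (p ⊛ q) r) (shift-cong (⊛-assoc p q r))))

  ⊛-∷ʳ : ∀ q b p → q ⊛ (b ∷ p) ≋ b · q ⊕ (0# ∷ q ⊛ p)
  ⊛-∷ʳ [] b p = ≋-sym shift-[]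
  ⊛-∷ʳ (c ∷ q) b p = ∷-cong c*b+0≈b*c+0 (begin⟨ ≋-setoid ⟩
    c · p ⊕ q ⊛ (b ∷ p)              ≈⟨ ⊕-cong ≋-refl (⊛-∷ʳ q b p) ⟩
    c · p ⊕ (b · q ⊕ (0# ∷ q ⊛ p))   ≈⟨ ⊕-assoc (c · p) (b · q) _ ⟨
    (c · p ⊕ b · q) ⊕ (0# ∷ q ⊛ p)   ≈⟨ ⊕-cong (⊕-comm (c · p) (b · q)) ≋-refl ⟩
    (b · q ⊕ c · p) ⊕ (0# ∷ q ⊛ p)   ≈⟨ ⊕-assoc (b · q) (c · p) _ ⟩
    b · q ⊕ (c · p ⊕ (0# ∷ q ⊛ p))   ∎)
    where
    c*b+0≈b*c+0 : c * b + 0# ≈ b * c + 0#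
    c*b+0≈b*c+0 = +-congʳ (*-comm c b)

  ⊛-comm : ∀ p q → p ⊛ q ≋ q ⊛ p
  ⊛-comm [] q = ≋-sym (⊛-zeroʳ q ≋-refl)
  ⊛-comm (a ∷ p) q = ≋-trans (⊕-cong ≋-refl (shift-cong (⊛-comm p q))) (≋-sym (⊛-∷ʳ q a p))

  ⊛-identityˡ : ∀ p → 1ₚ ⊛ p ≋ p
  ⊛-identityˡ p = ≋-trans (⊕-cong (·-identityˡ p) shift-[]) (⊕-identityʳ p)

  ⊛-identityʳ : ∀ p → p ⊛ 1ₚ ≋ p
  ⊛-identityʳ p = ≋-trans (⊛-comm p 1ₚ) (⊛-identityˡ p)

  Regular : A → Set (c ⊔ ℓ)
  Regular x = ∀ a → a * x ≈ 0# → a ≈ 0#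

  coeff₀-regular⇒regular : ∀ d → Regular (coeff d 0) → ∀ p → p ⊛ d ≋ [] → p ≋ []
  coeff₀-regular⇒regular d regular [] e = ≋-refl
  coeff₀-regular⇒regular d regular (a ∷ p) e = ∷-≋[] a≈0 (coeff₀-regular⇒regular d regular p p⊛d≋[])
    where
    a≈0 : a ≈ 0#
    a≈0 = regular a (trans (sym (coeff₀-⊛ (a ∷ p) d)) (at e 0))
    shifted : 0# ∷ p ⊛ d ≋ []
    shifted = ≋-trans (≋-sym (⊕-cong (·-zeroˡ d a≈0) ≋-refl)) e
    p⊛d≋[] : p ⊛ d ≋ []
    p⊛d≋[] = mk≋ λ n → at shifted (suc n)

  isCommutativeRing : IsCommutativeRing _≋_ _⊕_ _⊛_ ⊖_ [] 1ₚ
  isCommutativeRing = record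
    { isRing = record
      { +-isAbelianGroup = record
        { isGroup = record
          { isMonoid = record
            { isSemigroup = record
              { isMagma = record { isEquivalence = ≋-isEquivalence ; ∙-cong = ⊕-cong }
              ; assoc = ⊕-assoc }
            ; identity = (λ _ → ≋-refl) , ⊕-identityʳ }
          ; inverse = ⊕-inverseˡ , ⊕-inverseʳ
          ; ⁻¹-cong = ⊖-cong }
        ; comm = ⊕-comm }
      ; *-cong = ⊛-cong
      ; *-assoc = ⊛-assoc
      ; *-identity = ⊛-identityˡ , ⊛-identityʳ
      ; distrib = ⊛-distribˡ , ⊛-distribʳ }
    ; *-comm = ⊛-comm }

  commutativeRing : CommutativeRing c ℓ
  commutativeRing = record { isCommutativeRing = isCommutativeRing }

rebindOperations : ∀ {c ℓ} (R : CommutativeRing c ℓ) → let open CommutativeRing R in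
  (_+′_ _*′_ : Op₂ Carrier) (-′_ : Op₁ Carrier) →
  (∀ x y → x +′ y ≡ x + y) → (∀ x y → x *′ y ≡ x * y) → (∀ x → -′ x ≡ - x) →
  CommutativeRing c ℓ
rebindOperations R _+′_ _*′_ -′_ +′≡+ *′≡* -′≡- = record
  { Carrier = Carrier ; _≈_ = _≈_ ; _+_ = _+′_ ; _*_ = _*′_ ; -_ = -′_ ; 0# = 0# ; 1# = 1#
  ; isCommutativeRing = record
    { isRing = record
      { +-isAbelianGroup = record
        { isGroup = record
          { isMonoid = record
            { isSemigroup = record
              { isMagma = record
                { isEquivalence = isEquivalence
                ; ∙-cong = λ p q → via +′≈ (+-cong p q) +′≈ }
              ; assoc = λ x y z →
                  via (trans +′≈ (+-congʳ +′≈)) (+-assoc x y z) (trans +′≈ (+-congˡ +′≈)) }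
            ; identity = (λ x → trans +′≈ (+-identityˡ x)) , (λ x → trans +′≈ (+-identityʳ x)) }
          ; inverse = (λ x → trans +′≈ (trans (+-congʳ -′≈) (-‿inverseˡ x)))
                    , (λ x → trans +′≈ (trans (+-congˡ -′≈) (-‿inverseʳ x)))
          ; ⁻¹-cong = λ p → via -′≈ (-‿cong p) -′≈ }
        ; comm = λ x y → via +′≈ (+-comm x y) +′≈ }
      ; *-cong = λ p q → via *′≈ (*-cong p q) *′≈
      ; *-assoc = λ x y z →
          via (trans *′≈ (*-congʳ *′≈)) (*-assoc x y z) (trans *′≈ (*-congˡ *′≈))
      ; *-identity = (λ x → trans *′≈ (*-identityˡ x)) , (λ x → trans *′≈ (*-identityʳ x))
      ; distrib = (λ x y z →
                    via (trans *′≈ (*-congˡ +′≈)) (distribˡ x y z) (trans +′≈ (+-cong *′≈ *′≈)))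
                , (λ x y z →
                    via (trans *′≈ (*-congʳ +′≈)) (distribʳ x y z) (trans +′≈ (+-cong *′≈ *′≈))) }
    ; *-comm = λ x y → via *′≈ (*-comm x y) *′≈ } }
  where
  open CommutativeRing R
  via : ∀ {a b c d} → a ≈ b → b ≈ c → d ≈ c → a ≈ d
  via a≈b b≈c d≈c = trans a≈b (trans b≈c (sym d≈c))
  +′≈ : ∀ {x y} → x +′ y ≈ x + y
  +′≈ {x} {y} = reflexive (+′≡+ x y)
  *′≈ : ∀ {x y} → x *′ y ≈ x * y
  *′≈ {x} {y} = reflexive (*′≡* x y)
  -′≈ : ∀ {x} → -′ x ≈ - x
  -′≈ {x} = reflexive (-′≡- x)

-- ℤ[t] and ℤ[s,t]

open import Data.Bool using (true; false; if_then_else_)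
open import Data.Empty using (⊥-elim)
open import Data.Fin using (toℕ)
import Data.Fin.Properties as Fin
open import Data.Integer as ℤ using (ℤ; +_; +[1+_])
import Data.Integer.Properties as ℤ
open import Data.Maybe using (Maybe; just; nothing)
open import Data.Nat as ℕ using (_∸_; _≤_; _<_; z≤n; s≤s; _/_; _≡ᵇ_)
import Data.Nat.DivMod as ℕ
import Data.Nat.Properties as ℕ
open import Data.Nat.Tactic.RingSolver using (solve-∀)
open import Data.Sum using (_⊎_; inj₁; inj₂)
open import Function using (_∘_)
open import Relation.Binary.PropositionalEquality as ≡ using (_≢_; refl; cong; cong₂)
open import Relation.Nullary using (¬_; yes; no)
open import Relation.Nullary.Decidable using (_⊎-dec_)

open import Defs

module ℤ[t] = Polynomial ℤ.+-*-commutativeRing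

-- Defs' operations on ℤ[t] and ℤ[s,t] agree with those of Polynomial only propositionally.
+₁≡⊕ : ∀ p q → p +₁ q ≡ p ℤ[t].⊕ q
+₁≡⊕ [] q = refl
+₁≡⊕ (a ∷ p) [] = refl
+₁≡⊕ (a ∷ p) (b ∷ q) = cong (_ ∷_) (+₁≡⊕ p q)

*₁≡⊛ : ∀ p q → p *₁ q ≡ p ℤ[t].⊛ q
*₁≡⊛ [] q = refl
*₁≡⊛ (a ∷ p) q = ≡.trans (+₁≡⊕ (a ·₁ q) (+ 0 ∷ p *₁ q)) (cong (λ r → a ·₁ q ℤ[t].⊕ (+ 0 ∷ r)) (*₁≡⊛ p q))

ℤ[t]-commutativeRing : CommutativeRing 0ℓ 0ℓ
ℤ[t]-commutativeRing = rebindOperations ℤ[t].commutativeRing _+₁_ _*₁_ neg₁ +₁≡⊕ *₁≡⊛ (λ _ → refl)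

module ℤ[t][s] = Polynomial ℤ[t]-commutativeRing

+₂≡⊕ : ∀ p q → p +₂ q ≡ p ℤ[t][s].⊕ q
+₂≡⊕ [] q = refl
+₂≡⊕ (a ∷ p) [] = refl
+₂≡⊕ (a ∷ p) (b ∷ q) = cong (_ ∷_) (+₂≡⊕ p q)

*₂≡⊛ : ∀ p q → p *₂ q ≡ p ℤ[t][s].⊛ q
*₂≡⊛ [] q = refl
*₂≡⊛ (a ∷ p) q = ≡.trans (+₂≡⊕ (a ·₂ q) ([] ∷ p *₂ q)) (cong (λ r → a ·₂ q ℤ[t][s].⊕ ([] ∷ r)) (*₂≡⊛ p q))

ℤ[s,t]-commutativeRing : CommutativeRing 0ℓ 0ℓ
ℤ[s,t]-commutativeRing = rebindOperations ℤ[t][s].commutativeRing _+₂_ _*₂_ neg₂ +₂≡⊕ *₂≡⊛ (λ _ → refl)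

open CommutativeRing ℤ[s,t]-commutativeRing
  using (setoid; +-cong; +-congˡ; +-congʳ; *-cong; *-congˡ; *-congʳ; -‿cong)
  renaming (_≈_ to _≋_; refl to ≋-refl; reflexive to ≋-reflexive; sym to ≋-sym; trans to ≋-trans)
open import Relation.Binary.Reasoning.Setoid setoid

coeff₁≡coeff : ∀ p n → coeff₁ p n ≡ ℤ[t].coeff p n
coeff₁≡coeff [] n = refl
coeff₁≡coeff (a ∷ p) zero = refl
coeff₁≡coeff (a ∷ p) (suc n) = coeff₁≡coeff p n

coeff₂≡coeff : ∀ p m n → coeff₂ p m n ≡ ℤ[t].coeff (ℤ[t][s].coeff p m) n
coeff₂≡coeff [] m n = refl
coeff₂≡coeff (a ∷ p) zero n = coeff₁≡coeff a n
coeff₂≡coeff (a ∷ p) (suc m) n = coeff₂≡coeff p m n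

≋⇒≈₂ : ∀ {p q} → p ≋ q → p ≈₂ q
≋⇒≈₂ {p} {q} e m n = ≡.trans (coeff₂≡coeff p m n)
  (≡.trans (ℤ[t].at (ℤ[t][s].at e m) n) (≡.sym (coeff₂≡coeff q m n)))

≈₂⇒≋ : ∀ {p q} → p ≈₂ q → p ≋ q
≈₂⇒≋ {p} {q} e = ℤ[t][s].mk≋ λ m → ℤ[t].mk≋ λ n →
  ≡.trans (≡.sym (coeff₂≡coeff p m n)) (≡.trans (e m n) (coeff₂≡coeff q m n))

c₀ : P2 → ℤ
c₀ p = ℤ[t].coeff (ℤ[t][s].coeff p 0) 0

NonzeroConstant : P2 → Set
NonzeroConstant p = c₀ p ≢ + 0

c₀-cong : ∀ {p q} → p ≋ q → c₀ p ≡ c₀ q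
c₀-cong e = ℤ[t].at (ℤ[t][s].at e 0) 0

c₀-+ : ∀ p q → c₀ (p +₂ q) ≡ c₀ p ℤ.+ c₀ q
c₀-+ p q rewrite +₂≡⊕ p q =
  ≡.trans (ℤ[t].at (ℤ[t][s].coeff-⊕ p q 0) 0)
          (≡.trans (cong (λ r → ℤ[t].coeff r 0) (+₁≡⊕ p₀ q₀)) (ℤ[t].coeff-⊕ p₀ q₀ 0))
  where
  p₀ q₀ : P1
  p₀ = ℤ[t][s].coeff p 0
  q₀ = ℤ[t][s].coeff q 0

c₀-neg : ∀ p → c₀ (neg₂ p) ≡ ℤ.- c₀ p
c₀-neg p = ≡.trans (ℤ[t].at (ℤ[t][s].coeff-⊖ p 0) 0) (ℤ[t].coeff-⊖ (ℤ[t][s].coeff p 0) 0)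

c₀-* : ∀ p q → c₀ (p *₂ q) ≡ c₀ p ℤ.* c₀ q
c₀-* p q rewrite *₂≡⊛ p q =
  ≡.trans (ℤ[t].at (ℤ[t][s].coeff₀-⊛ p q) 0)
          (≡.trans (cong (λ r → ℤ[t].coeff r 0) (*₁≡⊛ p₀ q₀)) (ℤ[t].coeff₀-⊛ p₀ q₀))
  where
  p₀ q₀ : P1
  p₀ = ℤ[t][s].coeff p 0
  q₀ = ℤ[t][s].coeff q 0

*₂-nonzeroConstant : ∀ p q → NonzeroConstant p → NonzeroConstant q → NonzeroConstant (p *₂ q)
*₂-nonzeroConstant p q p₀≢0 q₀≢0 pq₀≡0
  with ℤ.i*j≡0⇒i≡0∨j≡0 (c₀ p) (≡.trans (≡.sym (c₀-* p q)) pq₀≡0)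
... | inj₁ p₀≡0 = p₀≢0 p₀≡0
... | inj₂ q₀≡0 = q₀≢0 q₀≡0

nonzeroConstant⇒regular : ∀ {d} → NonzeroConstant d → ∀ p → p *₂ d ≋ [] → p ≋ []
nonzeroConstant⇒regular {d} d₀≢0 p e =
  ℤ[t][s].coeff₀-regular⇒regular d regular-in-ℤ[t] p (≡.subst (ℤ[t][s]._≋ []) (*₂≡⊛ p d) e)
  where
  regular-in-ℤ : ∀ a → a ℤ.* c₀ d ≡ + 0 → a ≡ + 0
  regular-in-ℤ a a*d₀≡0 with ℤ.i*j≡0⇒i≡0∨j≡0 a a*d₀≡0
  ... | inj₁ a≡0 = a≡0
  ... | inj₂ d₀≡0 = ⊥-elim (d₀≢0 d₀≡0)
  regular-in-ℤ[t] : ∀ a → a *₁ ℤ[t][s].coeff d 0 ℤ[t].≋ [] → a ℤ[t].≋ []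
  regular-in-ℤ[t] a e =
    ℤ[t].coeff₀-regular⇒regular _ regular-in-ℤ a (≡.subst (ℤ[t]._≋ []) (*₁≡⊛ a _) e)

*₂-cancelʳ : ∀ {d} → NonzeroConstant d → ∀ {p q} → p *₂ d ≋ q *₂ d → p ≋ q
*₂-cancelʳ {d} d₀≢0 {p} {q} e =
  x∙y⁻¹≈ε⇒x≈y p q (nonzeroConstant⇒regular d₀≢0 (p +₂ neg₂ q) (begin
    (p +₂ neg₂ q) *₂ d              ≈⟨ [y-z]x≈yx-zx d p q ⟩
    (p *₂ d) +₂ neg₂ (q *₂ d)       ≈⟨ +-cong e ≋-refl ⟩
    (q *₂ d) +₂ neg₂ (q *₂ d)       ≈⟨ -‿inverseʳ (q *₂ d) ⟩
    []                              ∎))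
  where
  open CommutativeRing ℤ[s,t]-commutativeRing using (-‿inverseʳ)
  open import Algebra.Properties.Ring (CommutativeRing.ring ℤ[s,t]-commutativeRing)
    using (x∙y⁻¹≈ε⇒x≈y; [y-z]x≈yx-zx)

module ℤ[s,t]-Solver where

  open import Algebra.Solver.Ring.AlmostCommutativeRing
    using (fromCommutativeRing; _-Raw-AlmostCommutative⟶_)

  singleton : ℤ → P2
  singleton c = (c ∷ []) ∷ []

  -- Sending + 0 to [] makes the solver's con (+ 0) the zero polynomial [] on the nose.
  constant : ℤ → P2
  constant (+ 0) = []
  constant c = singleton c

  constant≋singleton : ∀ c → constant c ≋ singleton c
  constant≋singleton (+ 0) = ≋-sym (ℤ[t][s].∷-≋[] (ℤ[t].∷-≋[] refl ℤ[t].≋-refl) ≋-refl)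
  constant≋singleton +[1+ n ] = ≋-refl
  constant≋singleton ℤ.-[1+ n ] = ≋-refl

  via-singleton : ∀ {c P} → singleton c ≋ P → constant c ≋ P
  via-singleton {c} = ≋-trans (constant≋singleton c)

  constant-homomorphism :
    CommutativeRing.rawRing ℤ.+-*-commutativeRing
      -Raw-AlmostCommutative⟶ fromCommutativeRing ℤ[s,t]-commutativeRing
  constant-homomorphism = record
    { ⟦_⟧ = constant
    ; +-homo = λ a b → via-singleton (≋-sym (+-cong (constant≋singleton a) (constant≋singleton b)))
    ; *-homo = λ a b → via-singleton (≋-trans
        (ℤ[t][s].∷-cong (ℤ[t].∷-cong (≡.sym (ℤ.+-identityʳ (a ℤ.* b))) ℤ[t].≋-refl) ≋-refl)
        (≋-sym (*-cong (constant≋singleton a) (constant≋singleton b))))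
    ; -‿homo = λ a → via-singleton (≋-sym (-‿cong (constant≋singleton a)))
    ; 0-homo = ≋-refl
    ; 1-homo = ≋-refl }

  constant-≟ : ∀ a b → Maybe (constant a ≋ constant b)
  constant-≟ a b with a ℤ.≟ b
  ... | yes refl = just ≋-refl
  ... | no _ = nothing

  open import Algebra.Solver.Ring (CommutativeRing.rawRing ℤ.+-*-commutativeRing)
    (fromCommutativeRing ℤ[s,t]-commutativeRing) constant-homomorphism constant-≟ public

open ℤ[s,t]-Solver using (solve; _:=_; _:+_; _:*_; _:-_; :-_; con)

-- Fractions whose denominators have nonzero constant term

infix 4 _≅_/_ _≅ₚ_

record _≅_/_ (x : Frac) (P D : P2) : Set where
  constructor mk≅
  field
    cross : (num x *₂ D) ≋ (P *₂ den x)
    den-nonzero : NonzeroConstant (den x)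
    target-nonzero : NonzeroConstant D
open _≅_/_

_≅ₚ_ : Frac → P2 → Set
x ≅ₚ P = x ≅ P / one₂

one₂-nonzero : NonzeroConstant one₂
one₂-nonzero ()

≅-poly : ∀ a → (a // one₂) ≅ₚ a
≅-poly a = mk≅ ≋-refl one₂-nonzero one₂-nonzero

≅-resp : ∀ {x P D P′ D′} → x ≅ P / D → (P *₂ D′) ≋ (P′ *₂ D) → NonzeroConstant D′ → x ≅ P′ / D′
≅-resp {a // b} {P} {D} {P′} {D′} (mk≅ x≅ b≢0 D≢0) e D′≢0 = mk≅ (*₂-cancelʳ D≢0 (begin
  (a *₂ D′) *₂ D   ≈⟨ solve 3 (λ a D′ D → (a :* D′) :* D := (a :* D) :* D′) ≋-refl a D′ D ⟩
  (a *₂ D) *₂ D′   ≈⟨ *-cong x≅ ≋-refl ⟩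
  (P *₂ b) *₂ D′   ≈⟨ solve 3 (λ P b D′ → (P :* b) :* D′ := (P :* D′) :* b) ≋-refl P b D′ ⟩
  (P *₂ D′) *₂ b   ≈⟨ *-cong e ≋-refl ⟩
  (P′ *₂ D) *₂ b   ≈⟨ solve 3 (λ P′ D b → (P′ :* D) :* b := (P′ :* b) :* D) ≋-refl P′ D b ⟩
  (P′ *₂ b) *₂ D   ∎)) b≢0 D′≢0

≅-+ : ∀ {x y P D Q E} → x ≅ P / D → y ≅ Q / E → (x +F y) ≅ ((P *₂ E) +₂ (Q *₂ D)) / (D *₂ E)
≅-+ {a // b} {c // d} {P} {D} {Q} {E} (mk≅ x≅ b≢0 D≢0) (mk≅ y≅ d≢0 E≢0) = mk≅ (begin
  ((a *₂ d) +₂ (c *₂ b)) *₂ (D *₂ E)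
    ≈⟨ solve 6 (λ a b c d D E → (a :* d :+ c :* b) :* (D :* E)
                              := (a :* D) :* (d :* E) :+ (c :* E) :* (b :* D)) ≋-refl a b c d D E ⟩
  ((a *₂ D) *₂ (d *₂ E)) +₂ ((c *₂ E) *₂ (b *₂ D))
    ≈⟨ +-cong (*-cong x≅ ≋-refl) (*-cong y≅ ≋-refl) ⟩
  ((P *₂ b) *₂ (d *₂ E)) +₂ ((Q *₂ d) *₂ (b *₂ D))
    ≈⟨ solve 6 (λ P Q b d D E → (P :* b) :* (d :* E) :+ (Q :* d) :* (b :* D)
                              := (P :* E :+ Q :* D) :* (b :* d)) ≋-refl P Q b d D E ⟩
  ((P *₂ E) +₂ (Q *₂ D)) *₂ (b *₂ d) ∎)
  (*₂-nonzeroConstant b d b≢0 d≢0) (*₂-nonzeroConstant D E D≢0 E≢0)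

≅-* : ∀ {x y P D Q E} → x ≅ P / D → y ≅ Q / E → (x *F y) ≅ (P *₂ Q) / (D *₂ E)
≅-* {a // b} {c // d} {P} {D} {Q} {E} (mk≅ x≅ b≢0 D≢0) (mk≅ y≅ d≢0 E≢0) = mk≅ (begin
  (a *₂ c) *₂ (D *₂ E)   ≈⟨ solve 4 (λ a c D E → (a :* c) :* (D :* E) := (a :* D) :* (c :* E)) ≋-refl a c D E ⟩
  (a *₂ D) *₂ (c *₂ E)   ≈⟨ *-cong x≅ y≅ ⟩
  (P *₂ b) *₂ (Q *₂ d)   ≈⟨ solve 4 (λ P b Q d → (P :* b) :* (Q :* d) := (P :* Q) :* (b :* d)) ≋-refl P b Q d ⟩
  (P *₂ Q) *₂ (b *₂ d)   ∎)
  (*₂-nonzeroConstant b d b≢0 d≢0) (*₂-nonzeroConstant D E D≢0 E≢0)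

≅-neg : ∀ {x P D} → x ≅ P / D → (-F x) ≅ neg₂ P / D
≅-neg {a // b} {P} {D} (mk≅ x≅ b≢0 D≢0) = mk≅ (begin
  neg₂ a *₂ D     ≈⟨ solve 2 (λ a D → (:- a) :* D := :- (a :* D)) ≋-refl a D ⟩
  neg₂ (a *₂ D)   ≈⟨ -‿cong x≅ ⟩
  neg₂ (P *₂ b)   ≈⟨ solve 2 (λ P b → :- (P :* b) := (:- P) :* b) ≋-refl P b ⟩
  neg₂ P *₂ b     ∎) b≢0 D≢0

numerator-nonzero : ∀ {x Q E} → x ≅ Q / E → NonzeroConstant Q → NonzeroConstant (num x)
numerator-nonzero {c // d} {Q} {E} (mk≅ y≅ d≢0 E≢0) Q≢0 c₀≡0 =
  *₂-nonzeroConstant Q d Q≢0 d≢0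
    (≡.trans (≡.sym (c₀-cong y≅)) (≡.trans (c₀-* c E) (cong (ℤ._* c₀ E) c₀≡0)))

≅-÷ : ∀ {x y P D Q E} → x ≅ P / D → y ≅ Q / E → NonzeroConstant Q → (x ÷F y) ≅ (P *₂ E) / (D *₂ Q)
≅-÷ {a // b} {c // d} {P} {D} {Q} {E} (mk≅ x≅ b≢0 D≢0) y≅Q/E@(mk≅ y≅ d≢0 E≢0) Q≢0 = mk≅ (begin
  (a *₂ d) *₂ (D *₂ Q)   ≈⟨ solve 4 (λ a d D Q → (a :* d) :* (D :* Q) := (a :* D) :* (Q :* d)) ≋-refl a d D Q ⟩
  (a *₂ D) *₂ (Q *₂ d)   ≈⟨ *-cong x≅ (≋-sym y≅) ⟩
  (P *₂ b) *₂ (c *₂ E)   ≈⟨ solve 4 (λ P b c E → (P :* b) :* (c :* E) := (P :* E) :* (b :* c)) ≋-refl P b c E ⟩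
  (P *₂ E) *₂ (b *₂ c)   ∎)
  (*₂-nonzeroConstant b c b≢0 (numerator-nonzero y≅Q/E Q≢0)) (*₂-nonzeroConstant D Q D≢0 Q≢0)

≅⇒≈ : ∀ {x y P D Q E} → x ≅ P / D → y ≅ Q / E → (P *₂ E) ≋ (Q *₂ D) → x ≈ y
≅⇒≈ {a // b} {c // d} {P} {D} {Q} {E} (mk≅ x≅ b≢0 D≢0) (mk≅ y≅ d≢0 E≢0) e =
  ≋⇒≈₂ {a *₂ d} {c *₂ b} (*₂-cancelʳ (*₂-nonzeroConstant D E D≢0 E≢0) (begin
    (a *₂ d) *₂ (D *₂ E)   ≈⟨ solve 4 (λ a d D E → (a :* d) :* (D :* E) := (a :* D) :* (d :* E)) ≋-refl a d D E ⟩
    (a *₂ D) *₂ (d *₂ E)   ≈⟨ *-cong x≅ ≋-refl ⟩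
    (P *₂ b) *₂ (d *₂ E)   ≈⟨ solve 4 (λ P b d E → (P :* b) :* (d :* E) := (P :* E) :* (b :* d)) ≋-refl P b d E ⟩
    (P *₂ E) *₂ (b *₂ d)   ≈⟨ *-cong e ≋-refl ⟩
    (Q *₂ D) *₂ (b *₂ d)   ≈⟨ solve 4 (λ Q D b d → (Q :* D) :* (b :* d) := (Q :* d) :* (b :* D)) ≋-refl Q D b d ⟩
    (Q *₂ d) *₂ (b *₂ D)   ≈⟨ *-cong (≋-sym y≅) ≋-refl ⟩
    (c *₂ E) *₂ (b *₂ D)   ≈⟨ solve 4 (λ c E b D → (c :* E) :* (b :* D) := (c :* b) :* (D :* E)) ≋-refl c E b D ⟩
    (c *₂ b) *₂ (D *₂ E)   ∎))

≅ₚ-resp : ∀ {x P P′} → x ≅ₚ P → P ≋ P′ → x ≅ₚ P′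
≅ₚ-resp x≅P P≋P′ = ≅-resp x≅P (*-cong P≋P′ ≋-refl) one₂-nonzero

≅ₚ-+ : ∀ {x y P Q} → x ≅ₚ P → y ≅ₚ Q → (x +F y) ≅ₚ (P +₂ Q)
≅ₚ-+ {P = P} {Q} x≅P y≅Q = ≅-resp (≅-+ x≅P y≅Q)
  (solve 2 (λ P Q → (P :* con (+ 1) :+ Q :* con (+ 1)) :* con (+ 1) := (P :+ Q) :* (con (+ 1) :* con (+ 1)))
     ≋-refl P Q) one₂-nonzero

≅ₚ-* : ∀ {x y P Q} → x ≅ₚ P → y ≅ₚ Q → (x *F y) ≅ₚ (P *₂ Q)
≅ₚ-* {P = P} {Q} x≅P y≅Q = ≅-resp (≅-* x≅P y≅Q)
  (solve 2 (λ P Q → (P :* Q) :* con (+ 1) := (P :* Q) :* (con (+ 1) :* con (+ 1))) ≋-refl P Q) one₂-nonzero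

≅ₚ-- : ∀ {x y P Q} → x ≅ₚ P → y ≅ₚ Q → (x -F y) ≅ₚ (P +₂ neg₂ Q)
≅ₚ-- x≅P y≅Q = ≅ₚ-+ x≅P (≅-neg y≅Q)

infixr 8 _^₂_

_^₂_ : P2 → ℕ → P2
P ^₂ zero = one₂
P ^₂ suc n = P *₂ (P ^₂ n)

≅ₚ-^ : ∀ {x P} → x ≅ₚ P → ∀ n → (x ^F n) ≅ₚ (P ^₂ n)
≅ₚ-^ x≅P zero = ≅-poly one₂
≅ₚ-^ x≅P (suc n) = ≅ₚ-* x≅P (≅ₚ-^ x≅P n)

^₂-+ : ∀ P m n → P ^₂ (m ℕ.+ n) ≋ ((P ^₂ m) *₂ (P ^₂ n))
^₂-+ P zero n = solve 1 (λ X → X := con (+ 1) :* X) ≋-refl (P ^₂ n)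
^₂-+ P (suc m) n = begin
  P *₂ (P ^₂ (m ℕ.+ n))          ≈⟨ *-congˡ {P} (^₂-+ P m n) ⟩
  P *₂ ((P ^₂ m) *₂ (P ^₂ n))    ≈⟨ solve 3 (λ P X Y → P :* (X :* Y) := (P :* X) :* Y) ≋-refl P (P ^₂ m) (P ^₂ n) ⟩
  (P *₂ (P ^₂ m)) *₂ (P ^₂ n)    ∎

^₂-*-distrib : ∀ P Q n → (P *₂ Q) ^₂ n ≋ ((P ^₂ n) *₂ (Q ^₂ n))
^₂-*-distrib P Q zero = ≋-refl
^₂-*-distrib P Q (suc n) = begin
  (P *₂ Q) *₂ ((P *₂ Q) ^₂ n)        ≈⟨ *-congˡ {P *₂ Q} (^₂-*-distrib P Q n) ⟩
  (P *₂ Q) *₂ ((P ^₂ n) *₂ (Q ^₂ n)) ≈⟨ solve 4 (λ P Q X Y → (P :* Q) :* (X :* Y) := (P :* X) :* (Q :* Y))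
                                          ≋-refl P Q (P ^₂ n) (Q ^₂ n) ⟩
  (P *₂ (P ^₂ n)) *₂ (Q *₂ (Q ^₂ n)) ∎

s₂ t₂ q₂ z₂ : P2
s₂ = [] ∷ (+ 1 ∷ []) ∷ []
t₂ = (+ 0 ∷ + 1 ∷ []) ∷ []
q₂ = t₂ *₂ t₂
z₂ = s₂ *₂ s₂

qF≅ₚq₂ : qF ≅ₚ q₂
qF≅ₚq₂ = ≅ₚ-* (≅-poly t₂) (≅-poly t₂)

zF≅ₚz₂ : zF ≅ₚ z₂
zF≅ₚz₂ = ≅ₚ-* (≅-poly s₂) (≅-poly s₂)

-- q-Pochhammer symbols and q-binomial coefficients

qpoch₂ : ℕ → P2
qpoch₂ zero = one₂
qpoch₂ (suc m) = qpoch₂ m *₂ (one₂ +₂ neg₂ (q₂ ^₂ suc m))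

qbinom₂ : ℕ → ℕ → P2
qbinom₂ n zero = one₂
qbinom₂ zero (suc k) = []
qbinom₂ (suc n) (suc k) = qbinom₂ n (suc k) +₂ ((q₂ ^₂ (n ∸ k)) *₂ qbinom₂ n k)

qpoch≅ₚqpoch₂ : ∀ m → qpoch m ≅ₚ qpoch₂ m
qpoch≅ₚqpoch₂ zero = ≅-poly one₂
qpoch≅ₚqpoch₂ (suc m) = ≅ₚ-* (qpoch≅ₚqpoch₂ m) (≅ₚ-- (≅-poly one₂) (≅ₚ-^ qF≅ₚq₂ (suc m)))

c₀-1-q^suc : ∀ m → c₀ (one₂ +₂ neg₂ (q₂ ^₂ suc m)) ≡ + 1
c₀-1-q^suc m = ≡.trans (c₀-+ one₂ (neg₂ (q₂ ^₂ suc m)))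
  (cong (λ w → + 1 ℤ.+ w) (≡.trans (c₀-neg (q₂ ^₂ suc m)) (cong ℤ.-_ (c₀-* q₂ (q₂ ^₂ m)))))

c₀-qpoch₂ : ∀ m → c₀ (qpoch₂ m) ≡ + 1
c₀-qpoch₂ zero = refl
c₀-qpoch₂ (suc m) = ≡.trans (c₀-* (qpoch₂ m) (one₂ +₂ neg₂ (q₂ ^₂ suc m)))
  (cong₂ ℤ._*_ (c₀-qpoch₂ m) (c₀-1-q^suc m))

qpoch₂-nonzero : ∀ m → NonzeroConstant (qpoch₂ m)
qpoch₂-nonzero m c₀≡0 with ≡.trans (≡.sym (c₀-qpoch₂ m)) c₀≡0
... | ()

qbinom₂-vanish : ∀ n k → n < k → qbinom₂ n k ≋ []
qbinom₂-vanish zero (suc k) _ = ≋-refl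
qbinom₂-vanish (suc n) (suc k) (s≤s n<k) = begin
  qbinom₂ n (suc k) +₂ ((q₂ ^₂ (n ∸ k)) *₂ qbinom₂ n k)
    ≈⟨ +-cong (qbinom₂-vanish n (suc k) (ℕ.m<n⇒m<1+n n<k))
              (*-congˡ {q₂ ^₂ (n ∸ k)} (qbinom₂-vanish n k n<k)) ⟩
  [] +₂ ((q₂ ^₂ (n ∸ k)) *₂ [])
    ≈⟨ solve 1 (λ X → con (+ 0) :+ X :* con (+ 0) := con (+ 0)) ≋-refl (q₂ ^₂ (n ∸ k)) ⟩
  [] ∎

-- The inductive step of qpoch₂-factor, with a = q^{n-k}, b = q^{k+1} and c = q^{n+1}.
qpoch₂-pascal-step : ∀ N G₁ G₀ K E a b c →
  ((G₁ *₂ (K *₂ (one₂ +₂ neg₂ b))) *₂ E) ≋ (N *₂ (one₂ +₂ neg₂ a)) →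
  N ≋ ((G₀ *₂ K) *₂ E) →
  (a *₂ b) ≋ c →
  (N *₂ (one₂ +₂ neg₂ c)) ≋ (((G₁ +₂ (a *₂ G₀)) *₂ (K *₂ (one₂ +₂ neg₂ b))) *₂ E)
qpoch₂-pascal-step N G₁ G₀ K E a b c upper lower ab≋c = begin
  N *₂ (one₂ +₂ neg₂ c)
    ≈⟨ *-congˡ {N} (+-congˡ {one₂} (-‿cong (≋-sym ab≋c))) ⟩
  N *₂ (one₂ +₂ neg₂ (a *₂ b))
    ≈⟨ solve 3 (λ N a b → N :* (con (+ 1) :- a :* b)
                        := N :* (con (+ 1) :- a) :+ (a :* (con (+ 1) :- b)) :* N) ≋-refl N a b ⟩
  (N *₂ (one₂ +₂ neg₂ a)) +₂ ((a *₂ (one₂ +₂ neg₂ b)) *₂ N)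
    ≈⟨ +-cong (≋-sym upper) (*-congˡ {a *₂ (one₂ +₂ neg₂ b)} lower) ⟩
  ((G₁ *₂ (K *₂ (one₂ +₂ neg₂ b))) *₂ E) +₂ ((a *₂ (one₂ +₂ neg₂ b)) *₂ ((G₀ *₂ K) *₂ E))
    ≈⟨ solve 6 (λ G₁ G₀ K E a b →
         (G₁ :* (K :* (con (+ 1) :- b))) :* E :+ (a :* (con (+ 1) :- b)) :* ((G₀ :* K) :* E)
         := ((G₁ :+ a :* G₀) :* (K :* (con (+ 1) :- b))) :* E) ≋-refl G₁ G₀ K E a b ⟩
  ((G₁ +₂ (a *₂ G₀)) *₂ (K *₂ (one₂ +₂ neg₂ b))) *₂ E ∎

mutual
  qpoch₂-factor : ∀ n k → k ≤ n → qpoch₂ n ≋ ((qbinom₂ n k *₂ qpoch₂ k) *₂ qpoch₂ (n ∸ k))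
  qpoch₂-factor n zero _ = solve 1 (λ X → X := (con (+ 1) :* con (+ 1)) :* X) ≋-refl (qpoch₂ n)
  qpoch₂-factor (suc n) (suc k) (s≤s k≤n) =
    qpoch₂-pascal-step (qpoch₂ n) (qbinom₂ n (suc k)) (qbinom₂ n k) (qpoch₂ k) (qpoch₂ (n ∸ k))
      (q₂ ^₂ (n ∸ k)) (q₂ ^₂ suc k) (q₂ ^₂ suc n)
      (qpoch₂-factor-upper n k k≤n) (qpoch₂-factor n k k≤n) exponents
    where
    exponents : ((q₂ ^₂ (n ∸ k)) *₂ (q₂ ^₂ suc k)) ≋ (q₂ ^₂ suc n)
    exponents = ≋-trans (≋-sym (^₂-+ q₂ (n ∸ k) (suc k)))
      (≋-reflexive (cong (q₂ ^₂_) (≡.trans (ℕ.+-suc (n ∸ k) k) (cong suc (ℕ.m∸n+n≡m k≤n)))))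

  qpoch₂-factor-upper : ∀ n k → k ≤ n →
    ((qbinom₂ n (suc k) *₂ qpoch₂ (suc k)) *₂ qpoch₂ (n ∸ k)) ≋ (qpoch₂ n *₂ (one₂ +₂ neg₂ (q₂ ^₂ (n ∸ k))))
  qpoch₂-factor-upper n k k≤n with ℕ.m≤n⇒m<n∨m≡n k≤n
  ... | inj₂ refl rewrite ℕ.n∸n≡0 n = begin
    (qbinom₂ n (suc n) *₂ qpoch₂ (suc n)) *₂ one₂
      ≈⟨ *-congʳ (*-congʳ (qbinom₂-vanish n (suc n) ℕ.≤-refl)) ⟩
    ([] *₂ qpoch₂ (suc n)) *₂ one₂
      ≈⟨ solve 2 (λ X N → (con (+ 0) :* X) :* con (+ 1) := N :* (con (+ 1) :- con (+ 1)))
                 ≋-refl (qpoch₂ (suc n)) (qpoch₂ n) ⟩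
    qpoch₂ n *₂ (one₂ +₂ neg₂ one₂) ∎
  ... | inj₁ k<n rewrite ℕ.+-∸-assoc 1 k<n = begin
    (G *₂ K) *₂ (E *₂ (one₂ +₂ neg₂ (q₂ ^₂ suc e)))
      ≈⟨ solve 4 (λ G K E X → (G :* K) :* (E :* X) := ((G :* K) :* E) :* X)
                 ≋-refl G K E (one₂ +₂ neg₂ (q₂ ^₂ suc e)) ⟩
    ((G *₂ K) *₂ E) *₂ (one₂ +₂ neg₂ (q₂ ^₂ suc e))
      ≈⟨ *-congʳ (≋-sym (qpoch₂-factor n (suc k) k<n)) ⟩
    qpoch₂ n *₂ (one₂ +₂ neg₂ (q₂ ^₂ suc e)) ∎
    where
    e : ℕ
    e = n ∸ suc k
    G K E : P2
    G = qbinom₂ n (suc k)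
    K = qpoch₂ (suc k)
    E = qpoch₂ e

qbinom≅ₚqbinom₂ : ∀ n k → k ≤ n → qbinom n k ≅ₚ qbinom₂ n k
qbinom≅ₚqbinom₂ n k k≤n = ≅-resp
  (≅-÷ (qpoch≅ₚqpoch₂ n) (≅ₚ-* (qpoch≅ₚqpoch₂ k) (qpoch≅ₚqpoch₂ (n ∸ k)))
       (*₂-nonzeroConstant (qpoch₂ k) (qpoch₂ (n ∸ k)) (qpoch₂-nonzero k) (qpoch₂-nonzero (n ∸ k))))
  (begin
    (qpoch₂ n *₂ one₂) *₂ one₂
      ≈⟨ solve 1 (λ X → (X :* con (+ 1)) :* con (+ 1) := X) ≋-refl (qpoch₂ n) ⟩
    qpoch₂ n
      ≈⟨ qpoch₂-factor n k k≤n ⟩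
    (qbinom₂ n k *₂ qpoch₂ k) *₂ qpoch₂ (n ∸ k)
      ≈⟨ solve 3 (λ G A B → (G :* A) :* B := G :* (con (+ 1) :* (A :* B)))
                 ≋-refl (qbinom₂ n k) (qpoch₂ k) (qpoch₂ (n ∸ k)) ⟩
    qbinom₂ n k *₂ (one₂ *₂ (qpoch₂ k *₂ qpoch₂ (n ∸ k))) ∎)
  one₂-nonzero

-- The polynomials λ(j)

Σ₂ : ℕ → (ℕ → P2) → P2
Σ₂ zero f = []
Σ₂ (suc n) f = f 0 +₂ Σ₂ n (λ i → f (suc i))

Σ₂-cong : ∀ n {f g} → (∀ k → f k ≋ g k) → Σ₂ n f ≋ Σ₂ n g
Σ₂-cong zero f≋g = ≋-refl
Σ₂-cong (suc n) f≋g = +-cong (f≋g 0) (Σ₂-cong n (λ k → f≋g (suc k)))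

Σ₂-head : ∀ n f → (∀ k → f (suc k) ≋ []) → Σ₂ (suc n) f ≋ f 0
Σ₂-head n f tail≋[] =
  ≋-trans (+-congˡ {f 0} (Σ₂-vanish n _ tail≋[])) (solve 1 (λ X → X :+ con (+ 0) := X) ≋-refl (f 0))
  where
  Σ₂-vanish : ∀ n f → (∀ k → f k ≋ []) → Σ₂ n f ≋ []
  Σ₂-vanish zero f _ = ≋-refl
  Σ₂-vanish (suc n) f f≋[] = ≋-trans (+-cong (f≋[] 0) (Σ₂-vanish n _ (λ k → f≋[] (suc k)))) ≋-refl

Σ₂-linear : ∀ n f g c → Σ₂ n (λ k → f k +₂ neg₂ (c *₂ g k)) ≋ (Σ₂ n f +₂ neg₂ (c *₂ Σ₂ n g))
Σ₂-linear zero f g c = solve 1 (λ c → con (+ 0) := con (+ 0) :- c :* con (+ 0)) ≋-refl c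
Σ₂-linear (suc n) f g c = begin
  (f 0 +₂ neg₂ (c *₂ g 0)) +₂ Σ₂ n (λ k → f (suc k) +₂ neg₂ (c *₂ g (suc k)))
    ≈⟨ +-congˡ {f 0 +₂ neg₂ (c *₂ g 0)} (Σ₂-linear n (λ k → f (suc k)) (λ k → g (suc k)) c) ⟩
  (f 0 +₂ neg₂ (c *₂ g 0)) +₂ (F +₂ neg₂ (c *₂ G))
    ≈⟨ solve 5 (λ f₀ g₀ c F G → (f₀ :- c :* g₀) :+ (F :- c :* G) := (f₀ :+ F) :- c :* (g₀ :+ G))
               ≋-refl (f 0) (g 0) c F G ⟩
  (f 0 +₂ F) +₂ neg₂ (c *₂ (g 0 +₂ G)) ∎
  where
  F G : P2
  F = Σ₂ n (λ k → f (suc k))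
  G = Σ₂ n (λ k → g (suc k))

sumL-applyUpTo-≅ₚ : ∀ (g : ℕ → ℕ) n (F : ℕ → Frac) (P : ℕ → P2) →
  (∀ {i} → i < n → F (g i) ≅ₚ P i) → sumL (applyUpTo g n) F ≅ₚ Σ₂ n P
sumL-applyUpTo-≅ₚ g zero F P _ = ≅-poly []
sumL-applyUpTo-≅ₚ g (suc n) F P F≅P =
  ≅ₚ-+ (F≅P (s≤s z≤n)) (sumL-applyUpTo-≅ₚ (λ i → g (suc i)) n F (λ i → P (suc i)) (λ i<n → F≅P (s≤s i<n)))

lam-summand : ℕ → ℕ → Frac
lam-summand j k = qbinom (j ∸ k) k *F ((-F 1F) ^F k) *F (qF ^F (k ℕ.* (k ∸ 1))) *F (zF ^F k)

term₂ : ℕ → ℕ → P2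
term₂ j k = ((qbinom₂ (j ∸ k) k *₂ (neg₂ one₂ ^₂ k)) *₂ (q₂ ^₂ (k ℕ.* (k ∸ 1)))) *₂ (z₂ ^₂ k)

-- For k > n, qbinom n k is (q;q)_n / (q;q)_k rather than 0 (truncated subtraction),
-- hence the hypothesis k + k ≤ j.
lam-summand≅ₚterm₂ : ∀ j k → k ℕ.+ k ≤ j → lam-summand j k ≅ₚ term₂ j k
lam-summand≅ₚterm₂ j k k+k≤j =
  ≅ₚ-* (≅ₚ-* (≅ₚ-* (qbinom≅ₚqbinom₂ (j ∸ k) k k≤j∸k) (≅ₚ-^ (≅-neg (≅-poly one₂)) k))
             (≅ₚ-^ qF≅ₚq₂ (k ℕ.* (k ∸ 1))))
       (≅ₚ-^ zF≅ₚz₂ k)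
  where
  k≤j∸k : k ≤ j ∸ k
  k≤j∸k = ℕ.≤-trans (ℕ.≤-reflexive (≡.sym (ℕ.m+n∸m≡n k k))) (ℕ.∸-monoˡ-≤ k k+k≤j)

m*2≡m+m : ∀ m → m ℕ.* 2 ≡ m ℕ.+ m
m*2≡m+m = solve-∀

double-≤ : ∀ {i j} → i < suc (j / 2) → i ℕ.+ i ≤ j
double-≤ {i} {j} (s≤s i≤j/2) =
  ℕ.≤-trans (ℕ.+-mono-≤ i≤j/2 i≤j/2) (≡.subst (ℕ._≤ j) (m*2≡m+m (j / 2)) (ℕ.m/n*n≤m j 2))

lam≅ₚΣ₂term₂ : ∀ j → lam j ≅ₚ Σ₂ (suc (j / 2)) (term₂ j)
lam≅ₚΣ₂term₂ j =
  sumL-applyUpTo-≅ₚ (λ i → i) (suc (j / 2)) (lam-summand j) (term₂ j)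
    λ {i} i<n → lam-summand≅ₚterm₂ j i (double-≤ i<n)

Λ : ℕ → P2
Λ zero = one₂
Λ (suc zero) = one₂
Λ (suc (suc j)) = Λ (suc j) +₂ neg₂ ((z₂ *₂ (q₂ ^₂ j)) *₂ Λ j)

term₂-vanish : ∀ j k → j < k ℕ.+ k → term₂ j k ≋ []
term₂-vanish j k j<2k = begin
  ((qbinom₂ (j ∸ k) k *₂ M) *₂ C) *₂ Z
    ≈⟨ *-congʳ (*-congʳ (*-congʳ (qbinom₂-vanish (j ∸ k) k (j∸k<k k j<2k)))) ⟩
  (([] *₂ M) *₂ C) *₂ Z
    ≈⟨ solve 3 (λ M C Z → ((con (+ 0) :* M) :* C) :* Z := con (+ 0)) ≋-refl M C Z ⟩
  [] ∎
  where
  M C Z : P2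
  M = neg₂ one₂ ^₂ k
  C = q₂ ^₂ (k ℕ.* (k ∸ 1))
  Z = z₂ ^₂ k
  j∸k<k : ∀ k → j < k ℕ.+ k → j ∸ k < k
  j∸k<k (suc k) j<2k = ℕ.m<n+o⇒m∸n<o j (suc k) j<2k

exponent-identity : ∀ j k → k ℕ.+ k ≤ j → suc k ℕ.* k ℕ.+ ((j ∸ k) ∸ k) ≡ j ℕ.+ k ℕ.* (k ∸ 1)
exponent-identity j k 2k≤j =
  ≡.trans (cong (suc k ℕ.* k ℕ.+_) (ℕ.∸-+-assoc j k k))
          (≡.trans (rearrange k r) (cong (ℕ._+ k ℕ.* (k ∸ 1)) (ℕ.m+[n∸m]≡n 2k≤j)))
  where
  r : ℕ
  r = j ∸ (k ℕ.+ k)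
  rearrange : ∀ k r → suc k ℕ.* k ℕ.+ r ≡ (k ℕ.+ k) ℕ.+ r ℕ.+ k ℕ.* (k ∸ 1)
  rearrange zero r = ≡.sym (ℕ.+-identityʳ r)
  rearrange (suc m) r = rearrange-suc m r
    where
    rearrange-suc : ∀ m r → (2 ℕ.+ m) ℕ.* (1 ℕ.+ m) ℕ.+ r ≡ ((1 ℕ.+ m) ℕ.+ (1 ℕ.+ m)) ℕ.+ r ℕ.+ (1 ℕ.+ m) ℕ.* m
    rearrange-suc = solve-∀

-- The inductive step of term₂-rec, with B = q^{j-2k}, A = q^{(k+1)k}, Q = q^j, C = q^{k(k-1)}.
term₂-pascal-step : ∀ G₁ G₀ B A Q C M Z → (A *₂ B) ≋ (Q *₂ C) →
  ((((G₁ +₂ (B *₂ G₀)) *₂ (neg₂ one₂ *₂ M)) *₂ A) *₂ (z₂ *₂ Z)) ≋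
  ((((G₁ *₂ (neg₂ one₂ *₂ M)) *₂ A) *₂ (z₂ *₂ Z)) +₂ neg₂ ((z₂ *₂ Q) *₂ (((G₀ *₂ M) *₂ C) *₂ Z)))
term₂-pascal-step G₁ G₀ B A Q C M Z AB≋QC = begin
  (((G₁ +₂ (B *₂ G₀)) *₂ (neg₂ one₂ *₂ M)) *₂ A) *₂ (z₂ *₂ Z)
    ≈⟨ solve 7 (λ G₁ G₀ B A M Z z → (((G₁ :+ B :* G₀) :* ((:- con (+ 1)) :* M)) :* A) :* (z :* Z)
              := (((G₁ :* ((:- con (+ 1)) :* M)) :* A) :* (z :* Z)) :- (z :* ((A :* B) :* G₀)) :* (M :* Z))
              ≋-refl G₁ G₀ B A M Z z₂ ⟩
  T₁ +₂ neg₂ ((z₂ *₂ ((A *₂ B) *₂ G₀)) *₂ (M *₂ Z))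
    ≈⟨ +-congˡ {T₁} (-‿cong (*-congʳ (*-congˡ {z₂} (*-congʳ AB≋QC)))) ⟩
  T₁ +₂ neg₂ ((z₂ *₂ ((Q *₂ C) *₂ G₀)) *₂ (M *₂ Z))
    ≈⟨ solve 7 (λ T z Q C G₀ M Z → T :- (z :* ((Q :* C) :* G₀)) :* (M :* Z)
                                  := T :- (z :* Q) :* (((G₀ :* M) :* C) :* Z))
              ≋-refl T₁ z₂ Q C G₀ M Z ⟩
  T₁ +₂ neg₂ ((z₂ *₂ Q) *₂ (((G₀ *₂ M) *₂ C) *₂ Z)) ∎
  where
  T₁ : P2
  T₁ = ((G₁ *₂ (neg₂ one₂ *₂ M)) *₂ A) *₂ (z₂ *₂ Z)

term₂-rec : ∀ j k → term₂ (suc (suc j)) (suc k) ≋ (term₂ (suc j) (suc k) +₂ neg₂ ((z₂ *₂ (q₂ ^₂ j)) *₂ term₂ j k))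
term₂-rec j k with k ℕ.+ k ℕ.≤? j
... | yes 2k≤j rewrite ℕ.+-∸-assoc 1 (ℕ.≤-trans (ℕ.m≤m+n k k) 2k≤j) =
  term₂-pascal-step (qbinom₂ (j ∸ k) (suc k)) (qbinom₂ (j ∸ k) k) (q₂ ^₂ ((j ∸ k) ∸ k))
    (q₂ ^₂ (suc k ℕ.* k)) (q₂ ^₂ j) (q₂ ^₂ (k ℕ.* (k ∸ 1))) (neg₂ one₂ ^₂ k) (z₂ ^₂ k) exponents
  where
  exponents : ((q₂ ^₂ (suc k ℕ.* k)) *₂ (q₂ ^₂ ((j ∸ k) ∸ k))) ≋ ((q₂ ^₂ j) *₂ (q₂ ^₂ (k ℕ.* (k ∸ 1))))
  exponents = ≋-trans (≋-sym (^₂-+ q₂ (suc k ℕ.* k) ((j ∸ k) ∸ k)))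
    (≋-trans (≋-reflexive (cong (q₂ ^₂_) (exponent-identity j k 2k≤j))) (^₂-+ q₂ j (k ℕ.* (k ∸ 1))))
... | no 2k≰j = begin
  term₂ (suc (suc j)) (suc k)
    ≈⟨ term₂-vanish (suc (suc j)) (suc k) j+2<2k+2 ⟩
  []
    ≈⟨ solve 1 (λ c → con (+ 0) := con (+ 0) :- c :* con (+ 0)) ≋-refl (z₂ *₂ (q₂ ^₂ j)) ⟩
  [] +₂ neg₂ ((z₂ *₂ (q₂ ^₂ j)) *₂ [])
    ≈⟨ +-cong (term₂-vanish (suc j) (suc k) (ℕ.<⇒≤ j+2<2k+2))
              (-‿cong (*-congˡ {z₂ *₂ (q₂ ^₂ j)} (term₂-vanish j k j<2k))) ⟨
  term₂ (suc j) (suc k) +₂ neg₂ ((z₂ *₂ (q₂ ^₂ j)) *₂ term₂ j k) ∎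
  where
  j<2k : j < k ℕ.+ k
  j<2k = ℕ.≰⇒> 2k≰j
  j+2<2k+2 : suc (suc j) < suc k ℕ.+ suc k
  j+2<2k+2 = ≡.subst (suc (suc j) <_) (cong suc (≡.sym (ℕ.+-suc k k))) (s≤s (s≤s j<2k))

-- Every range N with 2N > j gives λ(j); this freedom lets the induction shift the range.
Σ₂term₂≋Λ : ∀ j N → j < N ℕ.+ N → Σ₂ N (term₂ j) ≋ Λ j
Σ₂term₂≋Λ zero (suc N) _ = Σ₂-head N (term₂ 0) λ k → term₂-vanish 0 (suc k) (s≤s z≤n)
Σ₂term₂≋Λ (suc zero) (suc N) _ = Σ₂-head N (term₂ 1) λ k →
  term₂-vanish 1 (suc k) (s≤s (ℕ.≤-trans (s≤s z≤n) (ℕ.m≤n+m (suc k) k)))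
Σ₂term₂≋Λ (suc (suc j)) (suc N) (s≤s j+2≤N+N+1) = begin
  term₂ (suc (suc j)) 0 +₂ Σ₂ N (λ k → term₂ (suc (suc j)) (suc k))
    ≈⟨ +-congˡ {term₂ (suc j) 0} (Σ₂-cong N (term₂-rec j)) ⟩
  term₂ (suc j) 0 +₂ Σ₂ N (λ k → term₂ (suc j) (suc k) +₂ neg₂ (c *₂ term₂ j k))
    ≈⟨ +-congˡ {term₂ (suc j) 0} (Σ₂-linear N (λ k → term₂ (suc j) (suc k)) (term₂ j) c) ⟩
  term₂ (suc j) 0 +₂ (Σ₂ N (λ k → term₂ (suc j) (suc k)) +₂ neg₂ (c *₂ Σ₂ N (term₂ j)))
    ≈⟨ solve 4 (λ a b c L → a :+ (b :- c :* L) := (a :+ b) :- c :* L)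
              ≋-refl (term₂ (suc j) 0) (Σ₂ N (λ k → term₂ (suc j) (suc k))) c (Σ₂ N (term₂ j)) ⟩
  Σ₂ (suc N) (term₂ (suc j)) +₂ neg₂ (c *₂ Σ₂ N (term₂ j))
    ≈⟨ +-cong (Σ₂term₂≋Λ (suc j) (suc N) j+1<2N+2) (-‿cong (*-congˡ {c} (Σ₂term₂≋Λ j N j<2N))) ⟩
  Λ (suc j) +₂ neg₂ (c *₂ Λ j) ∎
  where
  c : P2
  c = z₂ *₂ (q₂ ^₂ j)
  j+1<2N+2 : suc j < suc N ℕ.+ suc N
  j+1<2N+2 = ℕ.m≤n⇒m≤1+n j+2≤N+N+1
  j<2N : j < N ℕ.+ N
  j<2N = ℕ.≤-pred (≡.subst (suc (suc j) ≤_) (ℕ.+-suc N N) j+2≤N+N+1)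

lam≅ₚΛ : ∀ j → lam j ≅ₚ Λ j
lam≅ₚΛ j = ≅ₚ-resp (lam≅ₚΣ₂term₂ j) (Σ₂term₂≋Λ j (suc (j / 2)) j<N+N)
  where
  j<N+N : j < suc (j / 2) ℕ.+ suc (j / 2)
  j<N+N = ≡.subst₂ _<_ (≡.sym (ℕ.m≡m%n+[m/n]*n j 2)) (2+m*2≡1+m+1+m (j / 2))
                        (ℕ.+-monoˡ-< ((j / 2) ℕ.* 2) (ℕ.m%n<n j 2))
    where
    2+m*2≡1+m+1+m : ∀ m → 2 ℕ.+ m ℕ.* 2 ≡ suc m ℕ.+ suc m
    2+m*2≡1+m+1+m = solve-∀

c₀-Λ : ∀ j → c₀ (Λ j) ≡ + 1
c₀-Λ zero = refl
c₀-Λ (suc zero) = refl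
c₀-Λ (suc (suc j)) =
  ≡.trans (c₀-+ (Λ (suc j)) (neg₂ W))
    (cong₂ ℤ._+_ (c₀-Λ (suc j))
       (≡.trans (c₀-neg W)
          (cong ℤ.-_ (≡.trans (c₀-* (z₂ *₂ (q₂ ^₂ j)) (Λ j)) (cong (ℤ._* c₀ (Λ j)) (c₀-* z₂ (q₂ ^₂ j)))))))
  where
  W : P2
  W = (z₂ *₂ (q₂ ^₂ j)) *₂ Λ j

Λ-nonzero : ∀ j → NonzeroConstant (Λ j)
Λ-nonzero j c₀≡0 with ≡.trans (≡.sym (c₀-Λ j)) c₀≡0
... | ()

lam≉0F : ∀ j → ¬ (lam j ≈ 0F)
lam≉0F j lam≈0 = *₂-nonzeroConstant (Λ j) (den (lam j)) (Λ-nonzero j) (den-nonzero lam≅Λ)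
  (≡.trans (≡.sym (c₀-cong (cross lam≅Λ))) (c₀-cong (≈₂⇒≋ {num (lam j) *₂ one₂} {[] *₂ den (lam j)} lam≈0)))
  where
  lam≅Λ : lam j ≅ₚ Λ j
  lam≅Λ = lam≅ₚΛ j

-- The LU factorization

st : ℕ → Frac
st c = sF *F (tF ^F c)

stₚ : ℕ → P2
stₚ c = s₂ *₂ (t₂ ^₂ c)

-- Lmat n i j, Umat n i j and Mmat n i j are definitionally L′, U′ and M′ at toℕ i, toℕ j.
L′ U′ M′ : ℕ → ℕ → Frac
L′ a b =
  if a ≡ᵇ b then 1F
  else if a ≡ᵇ suc b then st b *F (lam b ÷F lam (suc b))
  else 0F
U′ a b =
  if a ≡ᵇ b then lam (suc a) ÷F lam a
  else if suc a ≡ᵇ b then st a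
  else 0F
M′ a b =
  if a ≡ᵇ b then 1F
  else if suc a ≡ᵇ b then st a
  else if a ≡ᵇ suc b then st b
  else 0F

≡ᵇ-refl : ∀ a → (a ≡ᵇ a) ≡ true
≡ᵇ-refl zero = refl
≡ᵇ-refl (suc a) = ≡ᵇ-refl a

≢⇒≡ᵇ-false : ∀ {a b} → a ≢ b → (a ≡ᵇ b) ≡ false
≢⇒≡ᵇ-false {zero} {zero} a≢b = ⊥-elim (a≢b refl)
≢⇒≡ᵇ-false {zero} {suc b} _ = refl
≢⇒≡ᵇ-false {suc a} {zero} _ = refl
≢⇒≡ᵇ-false {suc a} {suc b} a≢b = ≢⇒≡ᵇ-false (λ a≡b → a≢b (cong suc a≡b))

L′-diag : ∀ a → L′ a a ≡ 1F
L′-diag a rewrite ≡ᵇ-refl a = refl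

L′-sub : ∀ b → L′ (suc b) b ≡ st b *F (lam b ÷F lam (suc b))
L′-sub b rewrite ≢⇒≡ᵇ-false {suc b} {b} (λ ()) | ≡ᵇ-refl b = refl

L′-vanish : ∀ {a k} → a ≢ k → a ≢ suc k → L′ a k ≡ 0F
L′-vanish a≢k a≢k+1 rewrite ≢⇒≡ᵇ-false a≢k | ≢⇒≡ᵇ-false a≢k+1 = refl

U′-diag : ∀ k → U′ k k ≡ lam (suc k) ÷F lam k
U′-diag k rewrite ≡ᵇ-refl k = refl

U′-super : ∀ k → U′ k (suc k) ≡ st k
U′-super k rewrite ≢⇒≡ᵇ-false {k} {suc k} (λ ()) | ≡ᵇ-refl k = refl

U′-vanish : ∀ {k b} → k ≢ b → suc k ≢ b → U′ k b ≡ 0F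
U′-vanish k≢b k+1≢b rewrite ≢⇒≡ᵇ-false k≢b | ≢⇒≡ᵇ-false k+1≢b = refl

M′-diag : ∀ a → M′ a a ≡ 1F
M′-diag a rewrite ≡ᵇ-refl a = refl

M′-super : ∀ a → M′ a (suc a) ≡ st a
M′-super a rewrite ≢⇒≡ᵇ-false {a} {suc a} (λ ()) | ≡ᵇ-refl a = refl

M′-sub : ∀ b → M′ (suc b) b ≡ st b
M′-sub b rewrite ≢⇒≡ᵇ-false {suc b} {b} (λ ()) | ≢⇒≡ᵇ-false {suc (suc b)} {b} (λ ()) | ≡ᵇ-refl b = refl

M′-vanish : ∀ {a b} → a ≢ b → suc a ≢ b → a ≢ suc b → M′ a b ≡ 0F
M′-vanish a≢b a+1≢b a≢b+1 rewrite ≢⇒≡ᵇ-false a≢b | ≢⇒≡ᵇ-false a+1≢b | ≢⇒≡ᵇ-false a≢b+1 = refl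

st≅ₚstₚ : ∀ c → st c ≅ₚ stₚ c
st≅ₚstₚ c = ≅ₚ-* (≅-poly s₂) (≅ₚ-^ (≅-poly t₂) c)

lam-ratio≅ : ∀ i j → (lam i ÷F lam j) ≅ Λ i / Λ j
lam-ratio≅ i j = ≅-resp (≅-÷ (lam≅ₚΛ i) (lam≅ₚΛ j) (Λ-nonzero j))
  (solve 2 (λ A B → (A :* con (+ 1)) :* B := A :* (con (+ 1) :* B)) ≋-refl (Λ i) (Λ j)) (Λ-nonzero j)

L′-sub≅ : ∀ c → (st c *F (lam c ÷F lam (suc c))) ≅ (stₚ c *₂ Λ c) / Λ (suc c)
L′-sub≅ c = ≅-resp (≅-* (st≅ₚstₚ c) (lam-ratio≅ c (suc c)))
  (solve 3 (λ S A B → (S :* A) :* B := (S :* A) :* (con (+ 1) :* B)) ≋-refl (stₚ c) (Λ c) (Λ (suc c)))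
  (Λ-nonzero (suc c))

if-den-nonzero : ∀ c {x y} → NonzeroConstant (den x) → NonzeroConstant (den y) →
  NonzeroConstant (den (if c then x else y))
if-den-nonzero true x-ok _ = x-ok
if-den-nonzero false _ y-ok = y-ok

L′-den-nonzero : ∀ a b → NonzeroConstant (den (L′ a b))
L′-den-nonzero a b = if-den-nonzero (a ≡ᵇ b) one₂-nonzero
  (if-den-nonzero (a ≡ᵇ suc b) (den-nonzero (L′-sub≅ b)) one₂-nonzero)

U′-den-nonzero : ∀ a b → NonzeroConstant (den (U′ a b))
U′-den-nonzero a b = if-den-nonzero (a ≡ᵇ b) (den-nonzero (lam-ratio≅ (suc a) a))
  (if-den-nonzero (suc a ≡ᵇ b) (den-nonzero (st≅ₚstₚ a)) one₂-nonzero)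

*F-zeroˡ : ∀ y → NonzeroConstant (den y) → (0F *F y) ≅ₚ []
*F-zeroˡ y y-ok = mk≅ ≋-refl (*₂-nonzeroConstant one₂ (den y) one₂-nonzero y-ok) one₂-nonzero

*F-zeroʳ : ∀ x → NonzeroConstant (den x) → (x *F 0F) ≅ₚ []
*F-zeroʳ x x-ok = mk≅ (solve 1 (λ a → (a :* con (+ 0)) :* con (+ 1) := con (+ 0)) ≋-refl (num x))
  (*₂-nonzeroConstant (den x) one₂ x-ok one₂-nonzero) one₂-nonzero

LU-term : ℕ → ℕ → ℕ → Frac
LU-term a b k = L′ a k *F U′ k b

InBand : ℕ → ℕ → ℕ → Set
InBand a b k = (a ≡ k ⊎ a ≡ suc k) × (k ≡ b ⊎ suc k ≡ b)

LU-term-vanish : ∀ a b k → ¬ InBand a b k → LU-term a b k ≅ₚ []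
LU-term-vanish a b k outside with (a ℕ.≟ k) ⊎-dec (a ℕ.≟ suc k)
... | no a∉ rewrite L′-vanish (a∉ ∘ inj₁) (a∉ ∘ inj₂) = *F-zeroˡ (U′ k b) (U′-den-nonzero k b)
... | yes a∈ with (k ℕ.≟ b) ⊎-dec (suc k ℕ.≟ b)
...   | no b∉ rewrite U′-vanish (b∉ ∘ inj₁) (b∉ ∘ inj₂) = *F-zeroʳ (L′ a k) (L′-den-nonzero a k)
...   | yes b∈ = ⊥-elim (outside (a∈ , b∈))

sumN : ℕ → (ℕ → Frac) → Frac
sumN zero F = 0F
sumN (suc n) F = F 0 +F sumN n (λ i → F (suc i))

sumFin≡sumN : ∀ n (F : ℕ → Frac) → sumFin n (λ k → F (toℕ k)) ≡ sumN n F
sumFin≡sumN zero F = refl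
sumFin≡sumN (suc n) F = cong (F 0 +F_) (sumFin≡sumN n (λ i → F (suc i)))

sumN-vanish : ∀ n F → (∀ k → F k ≅ₚ []) → sumN n F ≅ₚ []
sumN-vanish zero F _ = ≅-poly []
sumN-vanish (suc n) F F≅0 = ≅ₚ-+ (F≅0 0) (sumN-vanish n (λ i → F (suc i)) (λ k → F≅0 (suc k)))

≅-+-zeroˡ : ∀ {x y P D} → x ≅ₚ [] → y ≅ P / D → (x +F y) ≅ P / D
≅-+-zeroˡ {P = P} {D} x≅0 y≅P/D = ≅-resp (≅-+ x≅0 y≅P/D)
  (solve 2 (λ P D → (con (+ 0) :* D :+ P :* con (+ 1)) :* D := P :* (con (+ 1) :* D)) ≋-refl P D)
  (target-nonzero y≅P/D)

sumN-single : ∀ n F p {P D} → p < n → F p ≅ P / D → (∀ k → k ≢ p → F k ≅ₚ []) → sumN n F ≅ P / D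
sumN-single (suc n) F zero {P} {D} _ F₀≅ others = ≅-resp
  (≅-+ F₀≅ (sumN-vanish n (λ i → F (suc i)) (λ k → others (suc k) (λ ()))))
  (solve 2 (λ P D → (P :* con (+ 1) :+ con (+ 0) :* D) :* D := P :* (D :* con (+ 1))) ≋-refl P D)
  (target-nonzero F₀≅)
sumN-single (suc n) F (suc p) (s≤s p<n) Fp≅ others = ≅-+-zeroˡ (others 0 (λ ()))
  (sumN-single n (λ i → F (suc i)) p p<n Fp≅ (λ k k≢p → others (suc k) (k≢p ∘ ℕ.suc-injective)))

sumN-pair : ∀ n F p {P D Q E} → suc p < n → F p ≅ P / D → F (suc p) ≅ Q / E →
  (∀ k → k ≢ p → k ≢ suc p → F k ≅ₚ []) → sumN n F ≅ ((P *₂ E) +₂ (Q *₂ D)) / (D *₂ E)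
sumN-pair (suc n) F zero (s≤s 1<n) F₀≅ F₁≅ others = ≅-+ F₀≅
  (sumN-single n (λ i → F (suc i)) 0 1<n F₁≅ (λ k k≢0 → others (suc k) (λ ()) (k≢0 ∘ ℕ.suc-injective)))
sumN-pair (suc n) F (suc p) (s≤s p+1<n) Fp≅ Fp+1≅ others = ≅-+-zeroˡ (others 0 (λ ()) (λ ()))
  (sumN-pair n (λ i → F (suc i)) p p+1<n Fp≅ Fp+1≅
     (λ k k≢p k≢p+1 → others (suc k) (k≢p ∘ ℕ.suc-injective) (k≢p+1 ∘ ℕ.suc-injective)))

LU-sum : ℕ → ℕ → ℕ → Frac
LU-sum n a b = sumN n (LU-term a b)

≅-≡ : ∀ {x y P D} → x ≡ y → y ≅ P / D → x ≅ P / D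
≅-≡ refl y≅ = y≅

stₚ²≋zq^ : ∀ c → (stₚ c *₂ stₚ c) ≋ (z₂ *₂ (q₂ ^₂ c))
stₚ²≋zq^ c = begin
  stₚ c *₂ stₚ c                  ≈⟨ solve 2 (λ s T → (s :* T) :* (s :* T) := (s :* s) :* (T :* T)) ≋-refl s₂ (t₂ ^₂ c) ⟩
  z₂ *₂ ((t₂ ^₂ c) *₂ (t₂ ^₂ c))  ≈⟨ *-congˡ {z₂} (^₂-*-distrib t₂ t₂ c) ⟨
  z₂ *₂ (q₂ ^₂ c)                 ∎

Λ-recurrence : ∀ c → (((stₚ c *₂ stₚ c) *₂ Λ c) +₂ Λ (suc (suc c))) ≋ Λ (suc c)
Λ-recurrence c = begin
  ((stₚ c *₂ stₚ c) *₂ Λ c) +₂ (Λ (suc c) +₂ neg₂ ((z₂ *₂ (q₂ ^₂ c)) *₂ Λ c))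
    ≈⟨ +-congʳ (*-congʳ (stₚ²≋zq^ c)) ⟩
  ((z₂ *₂ (q₂ ^₂ c)) *₂ Λ c) +₂ (Λ (suc c) +₂ neg₂ ((z₂ *₂ (q₂ ^₂ c)) *₂ Λ c))
    ≈⟨ solve 2 (λ W L → W :+ (L :- W) := L) ≋-refl ((z₂ *₂ (q₂ ^₂ c)) *₂ Λ c) (Λ (suc c)) ⟩
  Λ (suc c) ∎

a≢2+a : ∀ {a} → a ≢ suc (suc a)
a≢2+a ()

LU-entry-diag-zero : ∀ n → 0 < n → LU-sum n 0 0 ≈ M′ 0 0
LU-entry-diag-zero n 0<n =
  ≅⇒≈ (sumN-single n (LU-term 0 0) 0 0<n (≅-* (≅-poly one₂) (lam-ratio≅ 1 0)) others)
      (≅-poly one₂) ≋-refl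
  where
  others : ∀ k → k ≢ 0 → LU-term 0 0 k ≅ₚ []
  others k k≢0 = LU-term-vanish 0 0 k λ { (inj₁ 0≡k , _) → k≢0 (≡.sym 0≡k) ; (inj₂ () , _) }

LU-entry-diag-suc : ∀ n c → suc c < n → LU-sum n (suc c) (suc c) ≈ M′ (suc c) (suc c)
LU-entry-diag-suc n c c+1<n = ≅⇒≈ (sumN-pair n (LU-term (suc c) (suc c)) c c+1<n from-c from-c+1 others)
  (≅-≡ (M′-diag (suc c)) (≅-poly one₂)) (begin
    ((((stₚ c *₂ Λ c) *₂ stₚ c) *₂ (one₂ *₂ Λ₁)) +₂ ((one₂ *₂ Λ₂) *₂ (Λ₁ *₂ one₂))) *₂ one₂
      ≈⟨ solve 4 (λ S L₀ L₁ L₂ →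
             ((((S :* L₀) :* S) :* (con (+ 1) :* L₁)) :+ ((con (+ 1) :* L₂) :* (L₁ :* con (+ 1)))) :* con (+ 1)
             := (((S :* S) :* L₀) :+ L₂) :* L₁) ≋-refl (stₚ c) (Λ c) Λ₁ Λ₂ ⟩
    (((stₚ c *₂ stₚ c) *₂ Λ c) +₂ Λ₂) *₂ Λ₁
      ≈⟨ *-congʳ (Λ-recurrence c) ⟩
    Λ₁ *₂ Λ₁
      ≈⟨ solve 1 (λ L₁ → L₁ :* L₁ := con (+ 1) :* ((L₁ :* con (+ 1)) :* (con (+ 1) :* L₁))) ≋-refl Λ₁ ⟩
    one₂ *₂ ((Λ₁ *₂ one₂) *₂ (one₂ *₂ Λ₁)) ∎)
  where
  Λ₁ Λ₂ : P2
  Λ₁ = Λ (suc c)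
  Λ₂ = Λ (suc (suc c))
  from-c : LU-term (suc c) (suc c) c ≅ ((stₚ c *₂ Λ c) *₂ stₚ c) / (Λ₁ *₂ one₂)
  from-c = ≅-≡ (cong₂ _*F_ (L′-sub c) (U′-super c)) (≅-* (L′-sub≅ c) (st≅ₚstₚ c))
  from-c+1 : LU-term (suc c) (suc c) (suc c) ≅ (one₂ *₂ Λ₂) / (one₂ *₂ Λ₁)
  from-c+1 = ≅-≡ (cong₂ _*F_ (L′-diag (suc c)) (U′-diag (suc c)))
    (≅-* (≅-poly one₂) (lam-ratio≅ (suc (suc c)) (suc c)))
  others : ∀ k → k ≢ c → k ≢ suc c → LU-term (suc c) (suc c) k ≅ₚ []
  others k k≢c k≢c+1 = LU-term-vanish (suc c) (suc c) k λ
    { (inj₁ c+1≡k , _) → k≢c+1 (≡.sym c+1≡k)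
    ; (inj₂ c+1≡k+1 , _) → k≢c (≡.sym (ℕ.suc-injective c+1≡k+1)) }

LU-entry-super : ∀ n a → a < n → LU-sum n a (suc a) ≈ M′ a (suc a)
LU-entry-super n a a<n = ≅⇒≈ (sumN-single n (LU-term a (suc a)) a a<n from-a others)
  (≅-≡ (M′-super a) (st≅ₚstₚ a))
  (solve 1 (λ S → (con (+ 1) :* S) :* con (+ 1) := S :* (con (+ 1) :* con (+ 1))) ≋-refl (stₚ a))
  where
  from-a : LU-term a (suc a) a ≅ (one₂ *₂ stₚ a) / (one₂ *₂ one₂)
  from-a = ≅-≡ (cong₂ _*F_ (L′-diag a) (U′-super a)) (≅-* (≅-poly one₂) (st≅ₚstₚ a))
  others : ∀ k → k ≢ a → LU-term a (suc a) k ≅ₚ []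
  others k k≢a = LU-term-vanish a (suc a) k λ
    { (inj₁ a≡k , _) → k≢a (≡.sym a≡k)
    ; (inj₂ a≡k+1 , inj₁ k≡a+1) → a≢2+a (≡.trans a≡k+1 (cong suc k≡a+1))
    ; (inj₂ _ , inj₂ k+1≡a+1) → k≢a (ℕ.suc-injective k+1≡a+1) }

LU-entry-sub : ∀ n b → b < n → LU-sum n (suc b) b ≈ M′ (suc b) b
LU-entry-sub n b b<n = ≅⇒≈ (sumN-single n (LU-term (suc b) b) b b<n from-b others)
  (≅-≡ (M′-sub b) (st≅ₚstₚ b))
  (solve 3 (λ S L₀ L₁ → ((S :* L₀) :* L₁) :* con (+ 1) := S :* (L₁ :* L₀)) ≋-refl (stₚ b) (Λ b) (Λ (suc b)))
  where
  from-b : LU-term (suc b) b b ≅ ((stₚ b *₂ Λ b) *₂ Λ (suc b)) / (Λ (suc b) *₂ Λ b)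
  from-b = ≅-≡ (cong₂ _*F_ (L′-sub b) (U′-diag b)) (≅-* (L′-sub≅ b) (lam-ratio≅ (suc b) b))
  others : ∀ k → k ≢ b → LU-term (suc b) b k ≅ₚ []
  others k k≢b = LU-term-vanish (suc b) b k λ
    { (_ , inj₁ k≡b) → k≢b k≡b
    ; (inj₁ b+1≡k , inj₂ k+1≡b) → a≢2+a (≡.trans (≡.sym k+1≡b) (cong suc (≡.sym b+1≡k)))
    ; (inj₂ b+1≡k+1 , inj₂ _) → k≢b (≡.sym (ℕ.suc-injective b+1≡k+1)) }

LU-entry-off : ∀ n {a b} → a ≢ b → suc a ≢ b → a ≢ suc b → LU-sum n a b ≈ M′ a b
LU-entry-off n {a} {b} a≢b a+1≢b a≢b+1 =
  ≅⇒≈ (sumN-vanish n (LU-term a b) λ k → LU-term-vanish a b k (outside k))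
      (≅-≡ (M′-vanish a≢b a+1≢b a≢b+1) (≅-poly [])) ≋-refl
  where
  outside : ∀ k → ¬ InBand a b k
  outside k (inj₁ a≡k , inj₁ k≡b) = a≢b (≡.trans a≡k k≡b)
  outside k (inj₁ a≡k , inj₂ k+1≡b) = a+1≢b (≡.trans (cong suc a≡k) k+1≡b)
  outside k (inj₂ a≡k+1 , inj₁ k≡b) = a≢b+1 (≡.trans a≡k+1 (cong suc k≡b))
  outside k (inj₂ a≡k+1 , inj₂ k+1≡b) = a≢b (≡.trans a≡k+1 k+1≡b)

LU-entry : ∀ n a b → a < n → b < n → LU-sum n a b ≈ M′ a b
LU-entry n a b a<n b<n with a ℕ.≟ b | suc a ℕ.≟ b | a ℕ.≟ suc b
LU-entry n zero .zero a<n _ | yes refl | _ | _ = LU-entry-diag-zero n a<n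
LU-entry n (suc c) .(suc c) a<n _ | yes refl | _ | _ = LU-entry-diag-suc n c a<n
... | no _ | yes refl | _ = LU-entry-super n a a<n
... | no _ | no _ | yes refl = LU-entry-sub n b b<n
... | no a≢b | no a+1≢b | no a≢b+1 = LU-entry-off n a≢b a+1≢b a≢b+1

mainTheorem1 : ((j : ℕ) → ¬ (lam j ≈ 0F))
    × ((n : ℕ) → 1 ≤ n → (Lmat n ⊗ Umat n) ≈M Mmat n)
mainTheorem1 = lam≉0F , λ n _ i j →
  ≡.subst (_≈ Mmat n i j) (≡.sym (sumFin≡sumN n (LU-term (toℕ i) (toℕ j))))
    (LU-entry n (toℕ i) (toℕ j) (Fin.toℕ<n i) (Fin.toℕ<n j))
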